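{- Let $\mathcal G=(V,\mathcal E)$ be a loopless graph with no isolated vertices, and suppose $\mathcal G$ is disconnected. Then $\mathcal G$ is join-irreducible if and only if $\mathcal G$ is isomorphic to the disjoint union of $n$ copies of $K_3$ for some $n\ge 2$.
   Context: A graph $\mathcal G=(V,\mathcal E)$ has a finite vertex set $V=\{1,\dots,n\}$ and $\mathcal E\subseteq[V]^2\cup[V]^1$ (singletons are loops); it is loopless if $\mathcal E\subseteq[V]^2$. An isolated vertex is one lying in no edge. $f_{\mathcal G}\colon\{0,1\}^n\to\{0,1\}$ is the function computed by the $GF(2)$ polynomial $\sum_{E\in\mathcal E}\prod_{i\in E}x_i$, and $\mathcal G$ is called join-irreducible if $f_{\mathcal G}$ is. Simple minor order on Boolean functions: $g\le f$ if there is $\sigma\colon\{1,\dots,n\}\to\{1,\dots,m\}$ with $g(a_1,\dots,a_m)=f(a_{\sigma(1)},\dots,a_{\sigma(n)})$ for all $a_i$; $g<f$ if $g\le f$ and $f\not\le g$; $f$ is join-irreducible if there is $f'<f$ such that every $g<f$ satisfies $g\le f'$. $K_3$ is the complete graph on 3 vertices. -}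

module Defs where

open import Data.Nat using (ℕ; zero; suc; _+_; _*_; _<ᵇ_)
open import Data.Fin using (Fin; zero; suc; toℕ; splitAt; _≟_)
open import Data.Bool using (Bool; true; false; _∧_; _xor_; not; if_then_else_)
open import Data.Sum using (_⊎_; inj₁; inj₂)
open import Data.Product using (Σ; ∃; ∃-syntax; _×_; _,_)
open import Relation.Nullary using (¬_; does)
open import Relation.Binary.PropositionalEquality using (_≡_; refl; sym)
open import Relation.Binary.Construct.Closure.ReflexiveTransitive using (Star)
open import Function.Bundles using (_↔_; Inverse)

-- Graphs on V = Fin n.  An edge set ℰ ⊆ [V]²∪[V]¹ is encoded by a
-- symmetric Boolean relation: adj i j = true (i ≠ j) iff {i,j} ∈ ℰ,
-- and adj i i = true iff the loop {i} ∈ ℰ.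

record Graph (n : ℕ) : Set where
  field
    adj : Fin n → Fin n → Bool
    adj-sym : ∀ i j → adj i j ≡ adj j i
open Graph public

Loopless : ∀ {n} → Graph n → Set
Loopless G = ∀ i → adj G i i ≡ false

Isolated : ∀ {n} → Graph n → Fin n → Set
Isolated G i = ∀ j → adj G i j ≡ false

NoIsolated : ∀ {n} → Graph n → Set
NoIsolated G = ∀ i → ¬ Isolated G i

Adjacent : ∀ {n} → Graph n → Fin n → Fin n → Set
Adjacent G i j = adj G i j ≡ true

Reachable : ∀ {n} → Graph n → Fin n → Fin n → Set
Reachable G = Star (Adjacent G)

Connected : ∀ {n} → Graph n → Set
Connected G = ∀ i j → Reachable G i j

Disconnected : ∀ {n} → Graph n → Set
Disconnected G = ∃[ i ] ∃[ j ] ¬ Reachable G i j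

-- The GF(2) polynomial  Σ_{E∈ℰ} Π_{i∈E} x_i  as a Boolean function.

xorSum : ∀ {n} → (Fin n → Bool) → Bool
xorSum {zero} f = false
xorSum {suc n} f = f zero xor xorSum (λ i → f (suc i))

fG : ∀ {n} → Graph n → (Fin n → Bool) → Bool
fG G x =
  xorSum (λ i → adj G i i ∧ x i)
  xor xorSum (λ i → xorSum (λ j →
        if toℕ i <ᵇ toℕ j then adj G i j ∧ (x i ∧ x j) else false))

BoolFun : Set
BoolFun = Σ ℕ (λ m → (Fin m → Bool) → Bool)

_≤ₘ_ : BoolFun → BoolFun → Set
(m , g) ≤ₘ (n , f) = Σ (Fin n → Fin m) (λ σ → ∀ a → g a ≡ f (λ i → a (σ i)))

_<ₘ_ : BoolFun → BoolFun → Set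
g <ₘ f = g ≤ₘ f × ¬ (f ≤ₘ g)

JoinIrreducible : BoolFun → Set
JoinIrreducible f = ∃[ f' ] (f' <ₘ f × (∀ g → g <ₘ f → g ≤ₘ f'))

graphFun : ∀ {n} → Graph n → BoolFun
graphFun {n} G = n , fG G

GraphJoinIrreducible : ∀ {n} → Graph n → Set
GraphJoinIrreducible G = JoinIrreducible (graphFun G)

_≅_ : ∀ {n m} → Graph n → Graph m → Set
_≅_ {n} {m} G H = Σ (Fin n ↔ Fin m) (λ π →
  ∀ i j → adj G i j ≡ adj H (Inverse.to π i) (Inverse.to π j))

complete : (n : ℕ) → Graph n
complete n = record
  { adj = λ i j → not (does (i ≟ j))
  ; adj-sym = λ i j → sym-≟ i j }
  where
  sym-≟ : ∀ (i j : Fin n) → not (does (i ≟ j)) ≡ not (does (j ≟ i))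
  sym-≟ i j with i ≟ j | j ≟ i
  ... | Relation.Nullary.yes _ | Relation.Nullary.yes _ = refl
  ... | Relation.Nullary.no _  | Relation.Nullary.no _  = refl
  ... | Relation.Nullary.yes p | Relation.Nullary.no q  = Data.Empty.⊥-elim (q (sym p))
    where import Data.Empty
  ... | Relation.Nullary.no q  | Relation.Nullary.yes p = Data.Empty.⊥-elim (q (sym p))
    where import Data.Empty

K₃ : Graph 3
K₃ = complete 3

-- disjoint union: vertices of G first, then those of H
_⊕_ : ∀ {n m} → Graph n → Graph m → Graph (n + m)
_⊕_ {n} {m} G H = record { adj = a ; adj-sym = s }
  where
  a : Fin (n + m) → Fin (n + m) → Bool
  a i j with splitAt n i | splitAt n j
  ... | inj₁ i' | inj₁ j' = adj G i' j'
  ... | inj₂ i' | inj₂ j' = adj H i' j'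
  ... | inj₁ _  | inj₂ _  = false
  ... | inj₂ _  | inj₁ _  = false
  s : ∀ i j → a i j ≡ a j i
  s i j with splitAt n i | splitAt n j
  ... | inj₁ i' | inj₁ j' = adj-sym G i' j'
  ... | inj₂ i' | inj₂ j' = adj-sym H i' j'
  ... | inj₁ _  | inj₂ _  = refl
  ... | inj₂ _  | inj₁ _  = refl

emptyGraph : Graph 0
emptyGraph = record { adj = λ () ; adj-sym = λ () }

copies : ∀ {n} (k : ℕ) → Graph n → Graph (k * n)
copies zero G = emptyGraph
copies (suc k) G = G ⊕ copies k G

module Submission where

-- Over GF(2) the graph polynomial of a loopless graph is the quadratic form Σ_{ij∈E} x_i x_j.  Without isolated
-- vertices every variable of f_G is essential, so every proper minor of f_G lies below an identification minor
-- f_G(x with x_j := x_i).  If f_G is join-irreducible, all identification minors lie below a single one, say the one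
-- identifying p and q; evaluating along the minor maps at indicator vectors (using two vertices in different
-- components) shows that pq is a non-edge and that every edge ij has a vertex adjacent to exactly i and j, which
-- forces every component to be an isolated triangle.  Conversely, an isolated triangle contributes the majority of
-- its three variables to f_G, so permuting vertices inside a triangle and exchanging two triangles leave f_G
-- unchanged; these symmetries move every identification minor below the one identifying two vertices of different
-- triangles.

open import Defs
open import Data.Nat using (ℕ; _≤_)
open import Data.Product using (∃-syntax; _×_)
open import Function.Bundles using (_⇔_)

open import Data.Nat using (zero; suc; _+_; _<ᵇ_; z≤n; s≤s)
open import Data.Nat.Properties using (n≮n)
open import Data.Fin using (Fin; zero; suc; toℕ; _≟_; punchIn; punchOut; splitAt; _↑ˡ_; _↑ʳ_; join)
open import Data.Fin.Properties
  using (toℕ-injective; suc-injective; any?; all?; punchIn-injective; punchOut-injective; punchInᵢ≢i;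
         injective⇒≤; punchIn-punchOut; splitAt-↑ˡ; splitAt-↑ʳ; splitAt⁻¹-↑ˡ; splitAt⁻¹-↑ʳ; ↑ˡ-injective; ↑ʳ-injective)
open import Data.Fin.Permutation as Perm using (Permutation′; _⟨$⟩ʳ_; _⟨$⟩ˡ_; _∘ₚ_; inverseʳ)
open import Data.Fin.Permutation.Components using (transpose; transpose-inverse)
open import Data.Bool as Bool using (Bool; true; false; _∧_; _∨_; _xor_; not; if_then_else_)
open import Data.Bool.Properties
  using (∧-zeroʳ; ∧-identityʳ; ∨-zeroʳ; xor-identityʳ; xor-comm; xor-assoc; ∧-distribˡ-xor; ¬-not)
open import Data.Bool.Solver using (module xor-∧-Solver)
open import Data.Empty using (⊥-elim)
open import Data.Product using (Σ; _,_; proj₁; proj₂)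
open import Data.Sum using (_⊎_; inj₁; inj₂; [_,_]′)
import Data.Sum as Sum
open import Function.Base using (_∘_; _⟨_⟩_)
open import Function.Bundles using (Inverse; mk↔ₛ′; mk⇔)
open import Relation.Binary.Construct.Closure.ReflexiveTransitive using (ε; _◅_)
open import Relation.Binary.PropositionalEquality
open import Relation.Nullary using (¬_; Dec; does; yes; no)
open import Relation.Nullary.Decidable using (¬?; _×-dec_; _⊎-dec_; _→-dec_; dec-true; dec-false; toSum)

open xor-∧-Solver using (solve; _:+_; _:*_; _:=_; con)

false≢true : false ≢ true
false≢true ()

_==_ : ∀ {n} → Fin n → Fin n → Bool
i == j = does (i ≟ j)

==-refl : ∀ {n} (i : Fin n) → (i == i) ≡ true
==-refl i = dec-true (i ≟ i) refl

≢⇒==-false : ∀ {n} {i j : Fin n} → i ≢ j → (i == j) ≡ false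
≢⇒==-false {i = i} {j} = dec-false (i ≟ j)

_[_≔_] : ∀ {n} {A : Set} → (Fin n → A) → Fin n → A → Fin n → A
(y [ u ≔ z ]) i = if i == u then z else y i

≔-updates : ∀ {n} {A : Set} (y : Fin n → A) u z → (y [ u ≔ z ]) u ≡ z
≔-updates y u z rewrite ==-refl u = refl

≔-minimal : ∀ {n} {A : Set} (y : Fin n → A) {u i} z → i ≢ u → (y [ u ≔ z ]) i ≡ y i
≔-minimal y z i≢u rewrite ≢⇒==-false i≢u = refl

≔-split : ∀ {n} (y : Fin n → Bool) u i → y i ≡ (y [ u ≔ false ]) i xor ((λ _ → false) [ u ≔ y u ]) i
≔-split y u i with i ≟ u
... | yes refl = refl
... | no _ = sym (xor-identityʳ (y i))

xorSum-cong : ∀ {n} {f g : Fin n → Bool} → (∀ i → f i ≡ g i) → xorSum f ≡ xorSum g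
xorSum-cong {zero} f≗g = refl
xorSum-cong {suc n} f≗g = cong₂ _xor_ (f≗g zero) (xorSum-cong (λ i → f≗g (suc i)))

xorSum-false : ∀ {n} {f : Fin n → Bool} → (∀ i → f i ≡ false) → xorSum f ≡ false
xorSum-false {zero} f≗0 = refl
xorSum-false {suc n} f≗0 rewrite f≗0 zero = xorSum-false (λ i → f≗0 (suc i))

xorSum-xor : ∀ {n} (f g : Fin n → Bool) → xorSum (λ i → f i xor g i) ≡ xorSum f xor xorSum g
xorSum-xor {zero} f g = refl
xorSum-xor {suc n} f g rewrite xorSum-xor (λ i → f (suc i)) (λ i → g (suc i)) =
  interchange (f zero) (g zero) _ _
  where
  interchange : ∀ a b c d → (a xor b) xor (c xor d) ≡ (a xor c) xor (b xor d)
  interchange = solve 4 (λ a b c d → (a :+ b) :+ (c :+ d) := (a :+ c) :+ (b :+ d)) refl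

xorSum-∧ˡ : ∀ {n} (b : Bool) (f : Fin n → Bool) → xorSum (λ i → b ∧ f i) ≡ b ∧ xorSum f
xorSum-∧ˡ {zero} b f = sym (∧-zeroʳ b)
xorSum-∧ˡ {suc n} b f rewrite xorSum-∧ˡ b (λ i → f (suc i)) = sym (∧-distribˡ-xor b (f zero) _)

xorSum-single : ∀ {n} (f : Fin n → Bool) u → (∀ i → i ≢ u → f i ≡ false) → xorSum f ≡ f u
xorSum-single {suc n} f zero f≗0 =
  cong (f zero xor_) (xorSum-false (λ i → f≗0 (suc i) (λ ()))) ⟨ trans ⟩ xor-identityʳ (f zero)
xorSum-single {suc n} f (suc u) f≗0 rewrite f≗0 zero (λ ()) =
  xorSum-single (λ i → f (suc i)) u (λ i i≢u → f≗0 (suc i) (λ e → i≢u (suc-injective e)))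

xorSum-pair : ∀ {n} (f : Fin n → Bool) {a b} → a ≢ b →
  (∀ i → i ≢ a → i ≢ b → f i ≡ false) → xorSum f ≡ f a xor f b
xorSum-pair f {a} {b} a≢b f≗0 = begin
  xorSum f                    ≡⟨ xorSum-cong (≔-split f b) ⟩
  xorSum (λ i → g i xor h i)  ≡⟨ xorSum-xor g h ⟩
  xorSum g xor xorSum h       ≡⟨ cong₂ _xor_ (xorSum-single g a g≗0) (xorSum-single h b h≗0) ⟩
  g a xor h b                 ≡⟨ cong₂ _xor_ (≔-minimal f false a≢b) (≔-updates (λ _ → false) b (f b)) ⟩
  f a xor f b                 ∎
  where
  open ≡-Reasoning
  g h : Fin _ → Bool
  g = f [ b ≔ false ]
  h = (λ _ → false) [ b ≔ f b ]
  g≗0 : ∀ i → i ≢ a → g i ≡ false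
  g≗0 i i≢a with i ≟ b
  ... | yes _ = refl
  ... | no i≢b = f≗0 i i≢a i≢b
  h≗0 : ∀ i → i ≢ b → h i ≡ false
  h≗0 i i≢b rewrite ≢⇒==-false i≢b = refl

-- The graph polynomial of a loopless graph

bilinear : ∀ {n} → (Fin n → Fin n → Bool) → (Fin n → Bool) → (Fin n → Bool) → Bool
bilinear D a b = xorSum (λ i → xorSum (λ j → D i j ∧ (a i ∧ b j)))

upperAdj : ∀ {n} → Graph n → Fin n → Fin n → Bool
upperAdj G i j = if toℕ i <ᵇ toℕ j then adj G i j else false

neighbourSum : ∀ {n} → Graph n → Fin n → (Fin n → Bool) → Bool
neighbourSum G u y = xorSum (λ w → adj G u w ∧ y w)

fG-cong : ∀ {n} (G : Graph n) {y y′ : Fin n → Bool} → (∀ i → y i ≡ y′ i) → fG G y ≡ fG G y′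
fG-cong G y≗y′ = cong₂ _xor_
  (xorSum-cong (λ i → cong (adj G i i ∧_) (y≗y′ i)))
  (xorSum-cong (λ i → xorSum-cong (λ j → cong (λ v → if toℕ i <ᵇ toℕ j then v else false)
    (cong₂ (λ a b → adj G i j ∧ (a ∧ b)) (y≗y′ i) (y≗y′ j)))))

fG-loopless : ∀ {n} (G : Graph n) → Loopless G → ∀ y → fG G y ≡ bilinear (upperAdj G) y y
fG-loopless G loopless y = cong₂ _xor_
  (xorSum-false (λ i → cong (_∧ y i) (loopless i)))
  (xorSum-cong (λ i → xorSum-cong (λ j → if-∧ (toℕ i <ᵇ toℕ j) {adj G i j} {y i ∧ y j})))
  where
  if-∧ : ∀ c {a b} → (if c then a ∧ b else false) ≡ (if c then a else false) ∧ b
  if-∧ true = refl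
  if-∧ false = refl

xorSum₂-xor : ∀ {n} (A B : Fin n → Fin n → Bool) →
  xorSum (λ i → xorSum (λ j → A i j xor B i j)) ≡ xorSum (λ i → xorSum (A i)) xor xorSum (λ i → xorSum (B i))
xorSum₂-xor A B = xorSum-cong (λ i → xorSum-xor (A i) (B i)) ⟨ trans ⟩ xorSum-xor (λ i → xorSum (A i)) (λ i → xorSum (B i))

bilinear-xorˡ : ∀ {n} D (a a′ b : Fin n → Bool) → bilinear D (λ i → a i xor a′ i) b ≡ bilinear D a b xor bilinear D a′ b
bilinear-xorˡ D a a′ b = xorSum-cong (λ i → xorSum-cong (λ j → distrib (D i j) (a i) (a′ i) (b j)))
  ⟨ trans ⟩ xorSum₂-xor (λ i j → D i j ∧ (a i ∧ b j)) (λ i j → D i j ∧ (a′ i ∧ b j))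
  where
  distrib : ∀ d x x′ z → d ∧ ((x xor x′) ∧ z) ≡ (d ∧ (x ∧ z)) xor (d ∧ (x′ ∧ z))
  distrib = solve 4 (λ d x x′ z → d :* ((x :+ x′) :* z) := (d :* (x :* z)) :+ (d :* (x′ :* z))) refl

bilinear-xorʳ : ∀ {n} D (a b b′ : Fin n → Bool) → bilinear D a (λ j → b j xor b′ j) ≡ bilinear D a b xor bilinear D a b′
bilinear-xorʳ D a b b′ = xorSum-cong (λ i → xorSum-cong (λ j → distrib (D i j) (a i) (b j) (b′ j)))
  ⟨ trans ⟩ xorSum₂-xor (λ i j → D i j ∧ (a i ∧ b j)) (λ i j → D i j ∧ (a i ∧ b′ j))
  where
  distrib : ∀ d x z z′ → d ∧ (x ∧ (z xor z′)) ≡ (d ∧ (x ∧ z)) xor (d ∧ (x ∧ z′))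
  distrib = solve 4 (λ d x z z′ → d :* (x :* (z :+ z′)) := (d :* (x :* z)) :+ (d :* (x :* z′))) refl

bilinear-singleˡ : ∀ {n} D {a : Fin n → Bool} u → (∀ i → i ≢ u → a i ≡ false) → ∀ b →
  bilinear D a b ≡ a u ∧ xorSum (λ j → D u j ∧ b j)
bilinear-singleˡ D {a} u a≗0 b =
  xorSum-single _ u (λ i i≢u → xorSum-false (λ j → cong (λ v → D i j ∧ (v ∧ b j)) (a≗0 i i≢u) ⟨ trans ⟩ ∧-zeroʳ (D i j)))
  ⟨ trans ⟩ xorSum-cong (λ j → swap (D u j) (a u) (b j)) ⟨ trans ⟩ xorSum-∧ˡ (a u) (λ j → D u j ∧ b j)
  where
  swap : ∀ d x z → d ∧ (x ∧ z) ≡ x ∧ (d ∧ z)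
  swap = solve 3 (λ d x z → d :* (x :* z) := x :* (d :* z)) refl

bilinear-singleʳ : ∀ {n} D (a : Fin n → Bool) {b} u → (∀ j → j ≢ u → b j ≡ false) →
  bilinear D a b ≡ b u ∧ xorSum (λ i → D i u ∧ a i)
bilinear-singleʳ D a {b} u b≗0 =
  xorSum-cong (λ i → xorSum-single _ u (λ j j≢u → cong (λ v → D i j ∧ (a i ∧ v)) (b≗0 j j≢u) ⟨ trans ⟩ zero-out (D i j) (a i))
    ⟨ trans ⟩ swap (D i u) (a i) (b u))
  ⟨ trans ⟩ xorSum-∧ˡ (b u) (λ i → D i u ∧ a i)
  where
  zero-out : ∀ d x → d ∧ (x ∧ false) ≡ false
  zero-out d x rewrite ∧-zeroʳ x = ∧-zeroʳ d
  swap : ∀ d x z → d ∧ (x ∧ z) ≡ z ∧ (d ∧ x)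
  swap = solve 3 (λ d x z → d :* (x :* z) := z :* (d :* x)) refl

bilinear-cong : ∀ {n} D {a a′ b b′ : Fin n → Bool} → (∀ i → a i ≡ a′ i) → (∀ j → b j ≡ b′ j) →
  bilinear D a b ≡ bilinear D a′ b′
bilinear-cong D a≗a′ b≗b′ = xorSum-cong (λ i → xorSum-cong (λ j → cong₂ (λ x z → D i j ∧ (x ∧ z)) (a≗a′ i) (b≗b′ j)))

<ᵇ-irrefl : ∀ m → (m <ᵇ m) ≡ false
<ᵇ-irrefl zero = refl
<ᵇ-irrefl (suc m) = <ᵇ-irrefl m

<ᵇ-xor-<ᵇ : ∀ m n → m ≢ n → ((m <ᵇ n) xor (n <ᵇ m)) ≡ true
<ᵇ-xor-<ᵇ zero zero m≢n = ⊥-elim (m≢n refl)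
<ᵇ-xor-<ᵇ zero (suc n) _ = refl
<ᵇ-xor-<ᵇ (suc m) zero _ = refl
<ᵇ-xor-<ᵇ (suc m) (suc n) m≢n = <ᵇ-xor-<ᵇ m n (λ e → m≢n (cong suc e))

upperAdj-irrefl : ∀ {n} (G : Graph n) u → upperAdj G u u ≡ false
upperAdj-irrefl G u rewrite <ᵇ-irrefl (toℕ u) = refl

upperAdj-symmetrise : ∀ {n} (G : Graph n) → Loopless G → ∀ u j → upperAdj G u j xor upperAdj G j u ≡ adj G u j
upperAdj-symmetrise G loopless u j with u ≟ j
... | yes refl rewrite upperAdj-irrefl G u = sym (loopless u)
... | no u≢j = by-order (toℕ u <ᵇ toℕ j) (toℕ j <ᵇ toℕ u) (<ᵇ-xor-<ᵇ (toℕ u) (toℕ j) (λ e → u≢j (toℕ-injective e)))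
  where
  by-order : ∀ c c′ → c xor c′ ≡ true →
    (if c then adj G u j else false) xor (if c′ then adj G j u else false) ≡ adj G u j
  by-order true false _ = xor-identityʳ (adj G u j)
  by-order false true _ = adj-sym G j u

neighbourSum-≔ : ∀ {n} (G : Graph n) → Loopless G → ∀ u y z → neighbourSum G u (y [ u ≔ z ]) ≡ neighbourSum G u y
neighbourSum-≔ G loopless u y z = xorSum-cong same
  where
  same : ∀ w → adj G u w ∧ (y [ u ≔ z ]) w ≡ adj G u w ∧ y w
  same w with w ≟ u
  ... | yes refl rewrite loopless w = refl
  ... | no _ = refl

-- Split y into y′ = y [ u ≔ false ] and y u at u, and expand bilinearly: the two cross terms together
-- symmetrise upperAdj into the adjacency matrix.
fG-remove : ∀ {n} (G : Graph n) → Loopless G → ∀ y u →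
  fG G y ≡ fG G (y [ u ≔ false ]) xor (y u ∧ neighbourSum G u y)
fG-remove G loopless y u = begin
  fG G y                                                 ≡⟨ fG-loopless G loopless y ⟩
  bilinear D y y                                         ≡⟨ bilinear-cong D (≔-split y u) (≔-split y u) ⟩
  bilinear D (λ i → y′ i xor δ i) (λ j → y′ j xor δ j)
    ≡⟨ bilinear-xorˡ D y′ δ _ ⟨ trans ⟩ cong₂ _xor_ (bilinear-xorʳ D y′ y′ δ) (bilinear-xorʳ D δ y′ δ) ⟩
  (bilinear D y′ y′ xor bilinear D y′ δ) xor (bilinear D δ y′ xor bilinear D δ δ)
    ≡⟨ cong₂ (λ p q → (bilinear D y′ y′ xor p) xor (q xor bilinear D δ δ))
         (bilinear-singleʳ D y′ u δ≗0 ⟨ trans ⟩ cong (_∧ S↓) δu)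
         (bilinear-singleˡ D u δ≗0 y′ ⟨ trans ⟩ cong (_∧ S→) δu) ⟩
  (bilinear D y′ y′ xor (y u ∧ S↓)) xor ((y u ∧ S→) xor bilinear D δ δ)
    ≡⟨ cong (λ q → (bilinear D y′ y′ xor (y u ∧ S↓)) xor ((y u ∧ S→) xor q)) δδ ⟩
  (bilinear D y′ y′ xor (y u ∧ S↓)) xor ((y u ∧ S→) xor false)
    ≡⟨ collect (bilinear D y′ y′) (y u) S↓ S→ ⟩
  bilinear D y′ y′ xor (y u ∧ (S→ xor S↓))
    ≡⟨ cong₂ (λ p q → p xor (y u ∧ q)) (sym (fG-loopless G loopless y′)) neighbours ⟩
  fG G y′ xor (y u ∧ neighbourSum G u y)                 ∎
  where
  open ≡-Reasoning
  D = upperAdj G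
  y′ δ : Fin _ → Bool
  y′ = y [ u ≔ false ]
  δ = (λ _ → false) [ u ≔ y u ]
  S↓ S→ : Bool
  S↓ = xorSum (λ i → D i u ∧ y′ i)
  S→ = xorSum (λ j → D u j ∧ y′ j)
  δ≗0 : ∀ i → i ≢ u → δ i ≡ false
  δ≗0 i i≢u = ≔-minimal (λ _ → false) (y u) i≢u
  δu : δ u ≡ y u
  δu = ≔-updates (λ _ → false) u (y u)
  δδ : bilinear D δ δ ≡ false
  δδ = bilinear-singleˡ D u δ≗0 δ
    ⟨ trans ⟩ cong (δ u ∧_) (xorSum-single _ u (λ j j≢u → cong (D u j ∧_) (δ≗0 j j≢u) ⟨ trans ⟩ ∧-zeroʳ (D u j))
                             ⟨ trans ⟩ cong (_∧ δ u) (upperAdj-irrefl G u))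
    ⟨ trans ⟩ ∧-zeroʳ (δ u)
  collect : ∀ q x s t → (q xor (x ∧ s)) xor ((x ∧ t) xor false) ≡ q xor (x ∧ (t xor s))
  collect = solve 4 (λ q x s t → (q :+ (x :* s)) :+ ((x :* t) :+ con false) := q :+ (x :* (t :+ s))) refl
  symmetrise : ∀ j → (D u j ∧ y′ j) xor (D j u ∧ y′ j) ≡ adj G u j ∧ y′ j
  symmetrise j = sym (distribʳ (D u j) (D j u) (y′ j)) ⟨ trans ⟩ cong (_∧ y′ j) (upperAdj-symmetrise G loopless u j)
    where
    distribʳ : ∀ p q z → (p xor q) ∧ z ≡ (p ∧ z) xor (q ∧ z)
    distribʳ = solve 3 (λ p q z → (p :+ q) :* z := (p :* z) :+ (q :* z)) refl
  neighbours : S→ xor S↓ ≡ neighbourSum G u y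
  neighbours = sym (xorSum-xor (λ j → D u j ∧ y′ j) (λ i → D i u ∧ y′ i))
    ⟨ trans ⟩ xorSum-cong symmetrise ⟨ trans ⟩ neighbourSum-≔ G loopless u y false

fG-false : ∀ {n} (G : Graph n) {y : Fin n → Bool} → (∀ i → y i ≡ false) → fG G y ≡ false
fG-false G {y} y≗0 = cong₂ _xor_
  (xorSum-false (λ i → cong (adj G i i ∧_) (y≗0 i) ⟨ trans ⟩ ∧-zeroʳ (adj G i i)))
  (xorSum-false (λ i → xorSum-false (λ j → edge i j (toℕ i <ᵇ toℕ j))))
  where
  edge : ∀ i j c → (if c then adj G i j ∧ (y i ∧ y j) else false) ≡ false
  edge i j false = refl
  edge i j true rewrite y≗0 i = ∧-zeroʳ (adj G i j)

fG-singleton : ∀ {n} (G : Graph n) → Loopless G → ∀ {y} r → y r ≡ true → (∀ i → i ≢ r → y i ≡ false) →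
  fG G y ≡ false
fG-singleton G loopless {y} r yr y≗0 = begin
  fG G y                                                  ≡⟨ fG-remove G loopless y r ⟩
  fG G (y [ r ≔ false ]) xor (y r ∧ neighbourSum G r y)   ≡⟨ cong₂ _xor_ (fG-false G cleared) (cong (y r ∧_) isolated) ⟩
  false xor (y r ∧ false)                                 ≡⟨ ∧-zeroʳ (y r) ⟩
  false                                                   ∎
  where
  open ≡-Reasoning
  cleared : ∀ i → (y [ r ≔ false ]) i ≡ false
  cleared i with i ≟ r
  ... | yes _ = refl
  ... | no i≢r = y≗0 i i≢r
  isolated : neighbourSum G r y ≡ false
  isolated = xorSum-false (λ w → by-cases w)
    where
    by-cases : ∀ w → adj G r w ∧ y w ≡ false
    by-cases w with w ≟ r
    ... | yes refl rewrite loopless w = refl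
    ... | no w≢r rewrite y≗0 w w≢r = ∧-zeroʳ (adj G r w)

neighbourSum-single : ∀ {n} (G : Graph n) t {y : Fin n → Bool} r → y r ≡ true → (∀ i → i ≢ r → y i ≡ false) →
  neighbourSum G t y ≡ adj G t r
neighbourSum-single G t {y} r yr y≗0 =
  xorSum-single _ r (λ i i≢r → cong (adj G t i ∧_) (y≗0 i i≢r) ⟨ trans ⟩ ∧-zeroʳ (adj G t i))
  ⟨ trans ⟩ cong (adj G t r ∧_) yr ⟨ trans ⟩ ∧-identityʳ (adj G t r)

neighbourSum-pair : ∀ {n} (G : Graph n) t {y : Fin n → Bool} r s → r ≢ s → y r ≡ true → y s ≡ true →
  (∀ i → i ≢ r → i ≢ s → y i ≡ false) → neighbourSum G t y ≡ adj G t r xor adj G t s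
neighbourSum-pair G t {y} r s r≢s yr ys y≗0 =
  xorSum-pair _ r≢s (λ i i≢r i≢s → cong (adj G t i ∧_) (y≗0 i i≢r i≢s) ⟨ trans ⟩ ∧-zeroʳ (adj G t i))
  ⟨ trans ⟩ cong₂ _xor_ (cong (adj G t r ∧_) yr ⟨ trans ⟩ ∧-identityʳ _) (cong (adj G t s ∧_) ys ⟨ trans ⟩ ∧-identityʳ _)

fG-pair : ∀ {n} (G : Graph n) → Loopless G → ∀ {y} r s → r ≢ s → y r ≡ true → y s ≡ true →
  (∀ i → i ≢ r → i ≢ s → y i ≡ false) → fG G y ≡ adj G r s
fG-pair G loopless {y} r s r≢s yr ys y≗0 = begin
  fG G y                                                  ≡⟨ fG-remove G loopless y r ⟩
  fG G (y [ r ≔ false ]) xor (y r ∧ neighbourSum G r y)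
    ≡⟨ cong₂ _xor_ (fG-singleton G loopless s (≔-minimal y false (≢-sym r≢s) ⟨ trans ⟩ ys) cleared)
                   (cong₂ _∧_ yr (neighbourSum-pair G r r s r≢s yr ys y≗0)) ⟩
  false xor (true ∧ (adj G r r xor adj G r s))            ≡⟨ cong (_xor adj G r s) (loopless r) ⟩
  adj G r s                                               ∎
  where
  open ≡-Reasoning
  cleared : ∀ i → i ≢ s → (y [ r ≔ false ]) i ≡ false
  cleared i i≢s with i ≟ r
  ... | yes _ = refl
  ... | no i≢r = y≗0 i i≢r i≢s

Essential : ∀ {n} → ((Fin n → Bool) → Bool) → Fin n → Set
Essential F k = Σ _ λ a → F (a [ k ≔ false ]) ≢ F (a [ k ≔ true ])

fG-flips : ∀ {n} (G : Graph n) → Loopless G → ∀ k y → neighbourSum G k y ≡ true →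
  fG G (y [ k ≔ true ]) ≡ not (fG G (y [ k ≔ false ]))
fG-flips G loopless k y Nk = begin
  fG G (y [ k ≔ true ])
    ≡⟨ fG-remove G loopless (y [ k ≔ true ]) k ⟩
  fG G ((y [ k ≔ true ]) [ k ≔ false ]) xor ((y [ k ≔ true ]) k ∧ neighbourSum G k (y [ k ≔ true ]))
    ≡⟨ cong₂ _xor_ (fG-cong G overwrite)
                   (cong₂ _∧_ (≔-updates y k true) (neighbourSum-≔ G loopless k y true ⟨ trans ⟩ Nk)) ⟩
  fG G (y [ k ≔ false ]) xor true
    ≡⟨ xor-true (fG G (y [ k ≔ false ])) ⟩
  not (fG G (y [ k ≔ false ]))    ∎
  where
  open ≡-Reasoning
  overwrite : ∀ i → ((y [ k ≔ true ]) [ k ≔ false ]) i ≡ (y [ k ≔ false ]) i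
  overwrite i with i ≟ k
  ... | yes _ = refl
  ... | no _ = refl
  xor-true : ∀ b → b xor true ≡ not b
  xor-true true = refl
  xor-true false = refl

odd-neighbourSum⇒essential : ∀ {n} (G : Graph n) → Loopless G → ∀ k y → neighbourSum G k y ≡ true →
  fG G (y [ k ≔ false ]) ≢ fG G (y [ k ≔ true ])
odd-neighbourSum⇒essential G loopless k y Nk eq = b≢not-b (eq ⟨ trans ⟩ fG-flips G loopless k y Nk)
  where
  b≢not-b : ∀ {b} → b ≢ not b
  b≢not-b {true} ()
  b≢not-b {false} ()

record IsolatedTriangle {n} (G : Graph n) (u a b : Fin n) : Set where
  field
    u≢a : u ≢ a
    u≢b : u ≢ b
    a≢b : a ≢ b
    u~a : adj G u a ≡ true
    u~b : adj G u b ≡ true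
    a~b : adj G a b ≡ true
    N-u : ∀ w → adj G u w ≡ true → w ≡ a ⊎ w ≡ b
    N-a : ∀ w → adj G a w ≡ true → w ≡ u ⊎ w ≡ b
    N-b : ∀ w → adj G b w ≡ true → w ≡ u ⊎ w ≡ a

majority : Bool → Bool → Bool → Bool
majority x y z = (x ∧ y) xor ((x ∧ z) xor (y ∧ z))

clearNbhd : ∀ {n} → Graph n → Fin n → (Fin n → Bool) → Fin n → Bool
clearNbhd G u y i = if (i == u) ∨ adj G u i then false else y i

non-neighbour : ∀ {n} (G : Graph n) {u a b} → (∀ w → adj G u w ≡ true → w ≡ a ⊎ w ≡ b) →
  ∀ w → w ≢ a → w ≢ b → adj G u w ≡ false
non-neighbour G {u} N-u w w≢a w≢b with adj G u w in u~w
... | false = refl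
... | true with N-u w u~w
...   | inj₁ w≡a = ⊥-elim (w≢a w≡a)
...   | inj₂ w≡b = ⊥-elim (w≢b w≡b)

neighbourSum-degree-two : ∀ {n} (G : Graph n) u {a b} → a ≢ b → adj G u a ≡ true → adj G u b ≡ true →
  (∀ w → adj G u w ≡ true → w ≡ a ⊎ w ≡ b) → ∀ y → neighbourSum G u y ≡ y a xor y b
neighbourSum-degree-two G u {a} {b} a≢b u~a u~b N-u y =
  xorSum-pair _ a≢b (λ w w≢a w≢b → cong (_∧ y w) (non-neighbour G N-u w w≢a w≢b))
  ⟨ trans ⟩ cong₂ (λ p q → (p ∧ y a) xor (q ∧ y b)) u~a u~b

-- The three vertices are removed one after the other; the removed terms add up to the majority function.
fG-triangle : ∀ {n} (G : Graph n) → Loopless G → ∀ {u a b} → IsolatedTriangle G u a b →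
  ∀ y → fG G y ≡ majority (y u) (y a) (y b) xor fG G (clearNbhd G u y)
fG-triangle G loopless {u} {a} {b} T y = begin
  fG G y                                                    ≡⟨ remove-u ⟩
  fG G y₁ xor (y u ∧ (y a xor y b))                         ≡⟨ cong (_xor (y u ∧ (y a xor y b))) remove-a ⟩
  (fG G y₂ xor (y a ∧ y b)) xor (y u ∧ (y a xor y b))       ≡⟨ cong (λ p → (p xor (y a ∧ y b)) xor _) remove-b ⟩
  (fG G y₃ xor (y a ∧ y b)) xor (y u ∧ (y a xor y b))       ≡⟨ collect (fG G y₃) (y u) (y a) (y b) ⟩
  majority (y u) (y a) (y b) xor fG G y₃                    ≡⟨ cong (majority (y u) (y a) (y b) xor_) (fG-cong G cleared) ⟩
  majority (y u) (y a) (y b) xor fG G (clearNbhd G u y)     ∎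
  where
  open ≡-Reasoning
  open IsolatedTriangle T
  y₁ y₂ y₃ : Fin _ → Bool
  y₁ = y [ u ≔ false ]
  y₂ = y₁ [ a ≔ false ]
  y₃ = y₂ [ b ≔ false ]
  a~u = adj-sym G a u ⟨ trans ⟩ u~a
  b~u = adj-sym G b u ⟨ trans ⟩ u~b
  b~a = adj-sym G b a ⟨ trans ⟩ a~b
  y₁u : y₁ u ≡ false
  y₁u = ≔-updates y u false
  y₂u : y₂ u ≡ false
  y₂u = ≔-minimal y₁ false u≢a ⟨ trans ⟩ y₁u
  remove-u : fG G y ≡ fG G y₁ xor (y u ∧ (y a xor y b))
  remove-u = fG-remove G loopless y u
    ⟨ trans ⟩ cong (λ s → fG G y₁ xor (y u ∧ s)) (neighbourSum-degree-two G u a≢b u~a u~b N-u y)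
  remove-a : fG G y₁ ≡ fG G y₂ xor (y a ∧ y b)
  remove-a = fG-remove G loopless y₁ a
    ⟨ trans ⟩ cong (λ s → fG G y₂ xor (y₁ a ∧ s)) (neighbourSum-degree-two G a u≢b a~u a~b N-a y₁)
    ⟨ trans ⟩ cong₂ (λ p s → fG G y₂ xor (p ∧ s))
                    (≔-minimal y false (≢-sym u≢a)) (cong₂ _xor_ y₁u (≔-minimal y false (≢-sym u≢b)))
  remove-b : fG G y₂ ≡ fG G y₃
  remove-b = fG-remove G loopless y₂ b
    ⟨ trans ⟩ cong (λ s → fG G y₃ xor (y₂ b ∧ s)) (neighbourSum-degree-two G b u≢a b~u b~a N-b y₂)
    ⟨ trans ⟩ cong₂ (λ p q → fG G y₃ xor (y₂ b ∧ (p xor q))) y₂u (≔-updates y₁ a false)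
    ⟨ trans ⟩ cong (fG G y₃ xor_) (∧-zeroʳ (y₂ b)) ⟨ trans ⟩ xor-identityʳ (fG G y₃)
  collect : ∀ F x y z → (F xor (y ∧ z)) xor (x ∧ (y xor z)) ≡ majority x y z xor F
  collect = solve 4 (λ F x y z → (F :+ (y :* z)) :+ (x :* (y :+ z)) := ((x :* y) :+ ((x :* z) :+ (y :* z))) :+ F) refl
  cleared : ∀ i → y₃ i ≡ clearNbhd G u y i
  cleared i with i ≟ b
  ... | yes refl rewrite u~b | ∨-zeroʳ (i == u) = refl
  ... | no i≢b with i ≟ a
  ...   | yes refl rewrite u~a | ∨-zeroʳ (i == u) = refl
  ...   | no i≢a with i ≟ u
  ...     | yes refl = refl
  ...     | no i≢u rewrite non-neighbour G N-u i i≢a i≢b = refl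

-- Identification minors

≤ₘ-refl : ∀ f → f ≤ₘ f
≤ₘ-refl (n , f) = (λ i → i) , (λ a → refl)

≤ₘ-trans : ∀ {f g h} → f ≤ₘ g → g ≤ₘ h → f ≤ₘ h
≤ₘ-trans {m , f} {n , g} {p , h} (σ₁ , eq₁) (σ₂ , eq₂) = σ₁ ∘ σ₂ , (λ a → eq₁ a ⟨ trans ⟩ eq₂ (a ∘ σ₁))

identify : ∀ {n} → Fin n → Fin n → Fin n → Fin n
identify i j k = if k == j then i else k

identify-target : ∀ {n} (i j : Fin n) → identify i j j ≡ i
identify-target i j rewrite ==-refl j = refl

identify-other : ∀ {n} (i : Fin n) {j k} → k ≢ j → identify i j k ≡ k
identify-other i k≢j rewrite ≢⇒==-false k≢j = refl

fIdentify : ∀ {n} → Graph n → Fin n → Fin n → (Fin n → Bool) → Bool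
fIdentify G i j a = fG G (a ∘ identify i j)

Identification : ∀ {n} → Graph n → Fin n → Fin n → BoolFun
Identification {n} G i j = n , fIdentify G i j

Identification≤ₘgraph : ∀ {n} (G : Graph n) i j → Identification G i j ≤ₘ graphFun G
Identification≤ₘgraph G i j = identify i j , (λ a → refl)

-- A minor map that is injective has a left inverse (defaulting to the given vertex off its image), so the minor
-- is equivalent to f; a proper minor therefore identifies two variables.
<ₘgraph⇒≤ₘIdentification : ∀ {n} (G : Graph n) → Fin n → ∀ g → g <ₘ graphFun G →
  ∃[ i ] ∃[ j ] (i ≢ j × g ≤ₘ Identification G i j)
<ₘgraph⇒≤ₘIdentification {n} G i₀ (m , g) ((σ , g≡) , f≰g)
  with any? (λ i → any? (λ j → ¬? (i ≟ j) ×-dec (σ i ≟ σ j)))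
... | yes (i , j , i≢j , σi≡σj) = i , j , i≢j , σ , (λ a → g≡ a ⟨ trans ⟩ fG-cong G (merged a))
  where
  merged : ∀ a k → a (σ k) ≡ a (σ (identify i j k))
  merged a k with k ≟ j
  ... | yes refl = cong a (sym σi≡σj ⟨ trans ⟩ cong σ (sym (identify-target i k)))
  ... | no k≢j = cong (a ∘ σ) (sym (identify-other i k≢j))
... | no σ-injective = ⊥-elim (f≰g (τ , λ b → fG-cong G (λ i → cong b (sym (τ∘σ i))) ⟨ trans ⟩ sym (g≡ (b ∘ τ))))
  where
  injective : ∀ i j → σ i ≡ σ j → i ≡ j
  injective i j σi≡σj with i ≟ j
  ... | yes i≡j = i≡j
  ... | no i≢j = ⊥-elim (σ-injective (i , j , i≢j , σi≡σj))
  τ : Fin m → Fin n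
  τ x with any? (λ i → σ i ≟ x)
  ... | yes (i , _) = i
  ... | no _ = i₀
  τ∘σ : ∀ i → τ (σ i) ≡ i
  τ∘σ i with any? (λ i′ → σ i′ ≟ σ i)
  ... | yes (i′ , σi′≡σi) = injective i′ i σi′≡σi
  ... | no ∉image = ⊥-elim (∉image (i , refl))

essential⇒∈image : ∀ {n} (G : Graph n) (ρ : Fin n → Fin n) {F : (Fin n → Bool) → Bool} →
  (∀ b → F b ≡ fG G (b ∘ ρ)) → ∀ k → Essential F k → ∃[ x ] ρ x ≡ k
essential⇒∈image G ρ {F} F≡ k (a , flips) with any? (λ x → ρ x ≟ k)
... | yes k∈image = k∈image
... | no k∉image = ⊥-elim (flips (F≡ _ ⟨ trans ⟩ fG-cong G same ⟨ trans ⟩ sym (F≡ _)))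
  where
  same : ∀ i → (a [ k ≔ false ]) (ρ i) ≡ (a [ k ≔ true ]) (ρ i)
  same i = ≔-minimal a false ρi≢k ⟨ trans ⟩ sym (≔-minimal a true ρi≢k)
    where
    ρi≢k : ρ i ≢ k
    ρi≢k ρi≡k = k∉image (i , ρi≡k)

injective⇒surjective : ∀ {m} (g : Fin m → Fin m) → (∀ u v → g u ≡ g v → u ≡ v) → ∀ x → ∃[ u ] g u ≡ x
injective⇒surjective {suc m} g g-injective x with any? (λ u → g u ≟ x)
... | yes x∈image = x∈image
... | no x∉image = ⊥-elim (n≮n m (injective⇒≤ {f = g′} g′-injective))
  where
  g′ : Fin (suc m) → Fin m
  g′ u = punchOut {i = x} {j = g u} (λ x≡gu → x∉image (u , sym x≡gu))
  g′-injective : ∀ {u v} → g′ u ≡ g′ v → u ≡ v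
  g′-injective {u} {v} eq =
    g-injective u v (punchOut-injective (λ x≡gu → x∉image (u , sym x≡gu)) (λ x≡gv → x∉image (v , sym x≡gv)) eq)

-- A map Fin m → Fin (suc m) missing at most one point misses exactly that point, so it is injective.
almost-surjective⇒injective : ∀ {m} (h : Fin m → Fin (suc m)) j → (∀ t → t ≢ j → ∃[ x ] h x ≡ t) →
  ∀ x y → h x ≡ h y → x ≡ y
almost-surjective⇒injective h j hits = injective
  where
  g : _ → _
  g u = proj₁ (hits (punchIn j u) (punchInᵢ≢i j u))
  hg : ∀ u → h (g u) ≡ punchIn j u
  hg u = proj₂ (hits (punchIn j u) (punchInᵢ≢i j u))
  g-injective : ∀ u v → g u ≡ g v → u ≡ v
  g-injective u v eq = punchIn-injective j u v (sym (hg u) ⟨ trans ⟩ cong h eq ⟨ trans ⟩ hg v)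
  injective : ∀ x y → h x ≡ h y → x ≡ y
  injective x y hx≡hy with injective⇒surjective g g-injective x | injective⇒surjective g g-injective y
  ... | u , refl | v , refl = cong g (punchIn-injective j u v (sym (hg u) ⟨ trans ⟩ hx≡hy ⟨ trans ⟩ hg v))

indicator : ∀ {n} → Fin n → Fin n → Bool
indicator r k = k == r

indicator-true : ∀ {n} (r : Fin n) → indicator r r ≡ true
indicator-true = ==-refl

indicator-false : ∀ {n} (r : Fin n) k → k ≢ r → indicator r k ≡ false
indicator-false r k = ≢⇒==-false

has-neighbour : ∀ {n} (G : Graph n) → NoIsolated G → ∀ k → ∃[ l ] adj G k l ≡ true
has-neighbour G no-isolated k with any? (λ l → adj G k l Bool.≟ true)
... | yes k~l = k~l
... | no no-neighbour = ⊥-elim (no-isolated k (λ l → ¬-not (λ k~l → no-neighbour (l , k~l))))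

all-essential : ∀ {n} (G : Graph n) → Loopless G → NoIsolated G → ∀ k → Essential (fG G) k
all-essential G loopless no-isolated k with has-neighbour G no-isolated k
... | l , k~l = indicator l , odd-neighbourSum⇒essential G loopless k (indicator l)
  (neighbourSum-single G k l (indicator-true l) (indicator-false l) ⟨ trans ⟩ k~l)

∈image⇒∈image-avoiding : ∀ {m} (ρ : Fin (suc m) → Fin (suc m)) {p q} → p ≢ q → ρ p ≡ ρ q →
  ∀ {t} → ∃[ x ] ρ x ≡ t → ∃[ u ] ρ (punchIn q u) ≡ t
∈image⇒∈image-avoiding ρ {p} {q} p≢q ρp≡ρq (x , ρx≡t) with x ≟ q
... | yes refl = punchOut (≢-sym p≢q) , (cong ρ (punchIn-punchOut (≢-sym p≢q)) ⟨ trans ⟩ ρp≡ρq ⟨ trans ⟩ ρx≡t)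
... | no x≢q = punchOut (≢-sym x≢q) , (cong ρ (punchIn-punchOut (≢-sym x≢q)) ⟨ trans ⟩ ρx≡t)

-- Every variable of f must survive in a minor above f, but an identification minor has one variable too few.
graph≰ₘIdentification : ∀ {n} (G : Graph n) → (∀ k → Essential (fG G) k) →
  ∀ c d → c ≢ d → ¬ (graphFun G ≤ₘ Identification G c d)
graph≰ₘIdentification {suc m} G essential c d c≢d (σ , f≡) = n≮n m (injective⇒≤ {f = preimage} preimage-injective)
  where
  ρ : Fin (suc m) → Fin (suc m)
  ρ = σ ∘ identify c d
  ρc≡ρd : ρ c ≡ ρ d
  ρc≡ρd = cong σ (identify-other c c≢d ⟨ trans ⟩ sym (identify-target c d))
  hit : ∀ t → ∃[ u ] ρ (punchIn d u) ≡ t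
  hit t = ∈image⇒∈image-avoiding ρ c≢d ρc≡ρd (essential⇒∈image G ρ f≡ t (essential t))
  preimage : Fin (suc m) → Fin m
  preimage t = proj₁ (hit t)
  preimage-injective : ∀ {t t′} → preimage t ≡ preimage t′ → t ≡ t′
  preimage-injective {t} {t′} eq = sym (proj₂ (hit t)) ⟨ trans ⟩ cong (ρ ∘ punchIn d) eq ⟨ trans ⟩ proj₂ (hit t′)

-- A minor map ρ of G which merges p and q, and under which all variables but j are essential, merges nothing else.
module Collapse {m} (G : Graph (suc m)) (ρ : Fin (suc m) → Fin (suc m)) {F : (Fin (suc m) → Bool) → Bool}
  (F≡ : ∀ b → F b ≡ fG G (b ∘ ρ)) {p q j} (p≢q : p ≢ q) (ρp≡ρq : ρ p ≡ ρ q)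
  (essential : ∀ t → t ≢ j → Essential F t) where

  private
    ρ-avoiding-q-injective : ∀ x y → ρ (punchIn q x) ≡ ρ (punchIn q y) → x ≡ y
    ρ-avoiding-q-injective = almost-surjective⇒injective (ρ ∘ punchIn q) j
      (λ t t≢j → ∈image⇒∈image-avoiding ρ p≢q ρp≡ρq (essential⇒∈image G ρ F≡ t (essential t t≢j)))

  injective-off-q : ∀ x y → x ≢ q → y ≢ q → ρ x ≡ ρ y → x ≡ y
  injective-off-q x y x≢q y≢q ρx≡ρy = sym (punchIn-punchOut q≢x) ⟨ trans ⟩ cong (punchIn q) same ⟨ trans ⟩ punchIn-punchOut q≢y
    where
    q≢x = ≢-sym x≢q
    q≢y = ≢-sym y≢q
    same : punchOut q≢x ≡ punchOut q≢y
    same = ρ-avoiding-q-injective _ _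
      (cong ρ (punchIn-punchOut q≢x) ⟨ trans ⟩ ρx≡ρy ⟨ trans ⟩ sym (cong ρ (punchIn-punchOut q≢y)))

  fibre-of-ρp : ∀ x → ρ x ≡ ρ p → x ≡ p ⊎ x ≡ q
  fibre-of-ρp x ρx≡ρp with x ≟ q
  ... | yes x≡q = inj₂ x≡q
  ... | no x≢q = inj₁ (injective-off-q x p x≢q p≢q ρx≡ρp)

  injective-off-fibre : ∀ x y → ρ x ≡ ρ y → ρ x ≢ ρ p → x ≡ y
  injective-off-fibre x y ρx≡ρy ρx≢ρp =
    injective-off-q x y (λ { refl → ρx≢ρp (sym ρp≡ρq) }) (λ { refl → ρx≢ρp (ρx≡ρy ⟨ trans ⟩ sym ρp≡ρq) }) ρx≡ρy

  module _ (loopless : Loopless G) where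

    fG-indicator-ρp : fG G (indicator (ρ p) ∘ ρ) ≡ adj G p q
    fG-indicator-ρp = fG-pair G loopless p q p≢q (indicator-true (ρ p)) (dec-true (ρ q ≟ ρ p) (sym ρp≡ρq)) off-pq
      where
      off-pq : ∀ i → i ≢ p → i ≢ q → indicator (ρ p) (ρ i) ≡ false
      off-pq i i≢p i≢q with ρ i ≟ ρ p
      ... | no _ = refl
      ... | yes ρi≡ρp with fibre-of-ρp i ρi≡ρp
      ...   | inj₁ i≡p = ⊥-elim (i≢p i≡p)
      ...   | inj₂ i≡q = ⊥-elim (i≢q i≡q)

    fG-indicator-other : ∀ r → r ≢ ρ p → fG G (indicator r ∘ ρ) ≡ false
    fG-indicator-other r r≢ρp with any? (λ x → ρ x ≟ r)
    ... | no r∉image = fG-false G (λ k → indicator-false r (ρ k) (λ ρk≡r → r∉image (k , ρk≡r)))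
    ... | yes (x , ρx≡r) = fG-singleton G loopless x (dec-true (ρ x ≟ r) ρx≡r) off-x
      where
      off-x : ∀ k → k ≢ x → indicator r (ρ k) ≡ false
      off-x k k≢x with ρ k ≟ r
      ... | no _ = refl
      ... | yes ρk≡r = ⊥-elim (k≢x (injective-off-fibre k x (ρk≡r ⟨ trans ⟩ sym ρx≡r)
                                                          (λ ρk≡ρp → r≢ρp (sym ρk≡r ⟨ trans ⟩ ρk≡ρp))))

loopless⇒≢ : ∀ {n} (G : Graph n) → Loopless G → ∀ {i j} → adj G i j ≡ true → i ≢ j
loopless⇒≢ G loopless {i} i~j refl with () ← sym (loopless i) ⟨ trans ⟩ i~j

identify-pair : ∀ {n} {i j : Fin n} → i ≢ j → ∀ {y} → y i ≡ true → (∀ k → k ≢ i → y k ≡ false) →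
  (y ∘ identify i j) i ≡ true × (y ∘ identify i j) j ≡ true × (∀ k → k ≢ i → k ≢ j → (y ∘ identify i j) k ≡ false)
identify-pair {i = i} {j} i≢j {y} yi y≗0 =
  (cong y (identify-other i i≢j) ⟨ trans ⟩ yi) ,
  (cong y (identify-target i j) ⟨ trans ⟩ yi) ,
  λ k k≢i k≢j → cong y (identify-other i k≢j) ⟨ trans ⟩ y≗0 k k≢i

fIdentify-pair : ∀ {n} (G : Graph n) → Loopless G → ∀ {i j} → i ≢ j → ∀ {y} → y i ≡ true →
  (∀ k → k ≢ i → y k ≡ false) → fIdentify G i j y ≡ adj G i j
fIdentify-pair G loopless {i} {j} i≢j yi y≗0 with identify-pair i≢j yi y≗0
... | y′i , y′j , y′≗0 = fG-pair G loopless i j i≢j y′i y′j y′≗0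

essential-identify : ∀ {n} (G : Graph n) → Loopless G → ∀ {i j t} → t ≢ i → t ≢ j → ∀ y →
  neighbourSum G t (y ∘ identify i j) ≡ true → Essential (fIdentify G i j) t
essential-identify G loopless {i} {j} {t} t≢i t≢j y odd =
  y , λ eq → odd-neighbourSum⇒essential G loopless t (y ∘ identify i j) odd
                (sym (fG-cong G (commute false)) ⟨ trans ⟩ eq ⟨ trans ⟩ fG-cong G (commute true))
  where
  commute : ∀ z k → (y [ t ≔ z ]) (identify i j k) ≡ ((y ∘ identify i j) [ t ≔ z ]) k
  commute z k with k ≟ j
  ... | yes refl rewrite ≢⇒==-false (≢-sym t≢i) | ≢⇒==-false (≢-sym t≢j) = refl
  ... | no _ = refl

essential-identify-outer : ∀ {n} (G : Graph n) → Loopless G → ∀ {i j t l} → t ≢ i → t ≢ j →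
  adj G t l ≡ true → l ≢ i → l ≢ j → Essential (fIdentify G i j) t
essential-identify-outer G loopless {i} {j} {t} {l} t≢i t≢j t~l l≢i l≢j =
  essential-identify G loopless t≢i t≢j (indicator l)
    (neighbourSum-single G t l (cong (indicator l) (identify-other i l≢j) ⟨ trans ⟩ indicator-true l) off-l ⟨ trans ⟩ t~l)
  where
  off-l : ∀ k → k ≢ l → indicator l (identify i j k) ≡ false
  off-l k k≢l with k ≟ j
  ... | yes refl = indicator-false l i (≢-sym l≢i)
  ... | no _ = indicator-false l k k≢l

essential-identify-inner : ∀ {n} (G : Graph n) → Loopless G → ∀ {i j t} → t ≢ i → t ≢ j → i ≢ j →
  adj G t i xor adj G t j ≡ true → Essential (fIdentify G i j) t
essential-identify-inner G loopless {i} {j} {t} t≢i t≢j i≢j odd with identify-pair i≢j {indicator i} (indicator-true i) (indicator-false i)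
... | y′i , y′j , y′≗0 =
  essential-identify G loopless t≢i t≢j (indicator i) (neighbourSum-pair G t i j i≢j y′i y′j y′≗0 ⟨ trans ⟩ odd)

Special : ∀ {n} → Graph n → Fin n → Fin n → Fin n → Set
Special G i j k = adj G k i ≡ true × adj G k j ≡ true × (∀ w → adj G k w ≡ true → w ≡ i ⊎ w ≡ j)

special? : ∀ {n} (G : Graph n) i j k → Dec (Special G i j k)
special? G i j k = (adj G k i Bool.≟ true) ×-dec ((adj G k j Bool.≟ true) ×-dec
  all? (λ w → (adj G k w Bool.≟ true) →-dec ((w ≟ i) ⊎-dec (w ≟ j))))

essential-identify-edge : ∀ {n} (G : Graph n) → Loopless G → NoIsolated G → ∀ {i j} → adj G i j ≡ true →
  (∀ k → ¬ Special G i j k) → ∀ t → t ≢ j → Essential (fIdentify G i j) t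
essential-identify-edge G loopless no-isolated {i} {j} i~j no-special t t≢j with t ≟ i
... | yes refl = indicator t , λ eq → false≢true (sym off ⟨ trans ⟩ eq ⟨ trans ⟩ on)
  where
  i≢j = loopless⇒≢ G loopless i~j
  cleared : ∀ k → (indicator t [ t ≔ false ]) k ≡ false
  cleared k with k ≟ t
  ... | yes _ = refl
  ... | no _ = refl
  off : fIdentify G t j (indicator t [ t ≔ false ]) ≡ false
  off = fG-false G {(indicator t [ t ≔ false ]) ∘ identify t j} (λ k → cleared (identify t j k))
  on : fIdentify G t j (indicator t [ t ≔ true ]) ≡ true
  on = fIdentify-pair G loopless i≢j {indicator t [ t ≔ true ]} (≔-updates (indicator t) t true)
         (λ k k≢t → ≔-minimal (indicator t) true k≢t ⟨ trans ⟩ indicator-false t k k≢t)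
       ⟨ trans ⟩ i~j
... | no t≢i with any? (λ l → (adj G t l Bool.≟ true) ×-dec (¬? (l ≟ i) ×-dec ¬? (l ≟ j)))
...   | yes (l , t~l , l≢i , l≢j) = essential-identify-outer G loopless t≢i t≢j t~l l≢i l≢j
...   | no no-outer = essential-identify-inner G loopless t≢i t≢j (loopless⇒≢ G loopless i~j) odd
  where
  N-t : ∀ w → adj G t w ≡ true → w ≡ i ⊎ w ≡ j
  N-t w t~w with w ≟ i | w ≟ j
  ... | yes w≡i | _ = inj₁ w≡i
  ... | no _ | yes w≡j = inj₂ w≡j
  ... | no w≢i | no w≢j = ⊥-elim (no-outer (w , t~w , w≢i , w≢j))
  neighbour-in-ij : ∃[ l ] adj G t l ≡ true → adj G t i ≡ true ⊎ adj G t j ≡ true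
  neighbour-in-ij (l , t~l) with N-t l t~l
  ... | inj₁ refl = inj₁ t~l
  ... | inj₂ refl = inj₂ t~l
  odd : adj G t i xor adj G t j ≡ true
  odd with adj G t i in t~i | adj G t j in t~j
  ... | true | true = ⊥-elim (no-special t (t~i , t~j , N-t))
  ... | true | false = refl
  ... | false | true = refl
  ... | false | false with neighbour-in-ij (has-neighbour G no-isolated t)
  ...   | inj₁ t~i′ with () ← sym t~i ⟨ trans ⟩ t~i′
  ...   | inj₂ t~j′ with () ← sym t~j ⟨ trans ⟩ t~j′

fG-lonely : ∀ {n} (G : Graph n) → Loopless G → ∀ y d → (∀ w → adj G d w ≡ true → y w ≡ false) →
  fG G y ≡ fG G (y [ d ≔ false ])
fG-lonely G loopless y d lonely = fG-remove G loopless y d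
  ⟨ trans ⟩ cong (λ s → fG G (y [ d ≔ false ]) xor (y d ∧ s)) (xorSum-false quiet)
  ⟨ trans ⟩ cong (fG G (y [ d ≔ false ]) xor_) (∧-zeroʳ (y d)) ⟨ trans ⟩ xor-identityʳ _
  where
  quiet : ∀ w → adj G d w ∧ y w ≡ false
  quiet w with adj G d w in d~w
  ... | false = refl
  ... | true = lonely w d~w

module Separated {n} (G : Graph n) (loopless : Loopless G) {c d} (c↛d : ¬ Reachable G c d) where

  c≢d : c ≢ d
  c≢d refl = c↛d ε

  c≁d : adj G c d ≡ false
  c≁d = ¬-not (λ c~d → c↛d (c~d ◅ ε))

  c~l⇒l≁d : ∀ {l} → adj G c l ≡ true → adj G l d ≡ false
  c~l⇒l≁d c~l = ¬-not (λ l~d → c↛d (c~l ◅ l~d ◅ ε))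

  t~d⇒c≁t : ∀ {t} → adj G t d ≡ true → adj G c t ≡ false
  t~d⇒c≁t t~d = ¬-not (λ c~t → c↛d (c~t ◅ t~d ◅ ε))

  fIdentify-indicator : ∀ t → fIdentify G c d (indicator t) ≡ false
  fIdentify-indicator t with t ≟ c | t ≟ d
  ... | yes refl | _ = fIdentify-pair G loopless c≢d (indicator-true t) (indicator-false t) ⟨ trans ⟩ c≁d
  ... | no t≢c | yes refl = fG-false G (λ k → absent k)
    where
    absent : ∀ k → indicator t (identify c t k) ≡ false
    absent k with k ≟ t
    ... | yes refl = indicator-false k c (≢-sym t≢c)
    ... | no k≢t = indicator-false t k k≢t
  ... | no t≢c | no t≢d = fG-singleton G loopless t (cong (indicator t) (identify-other c t≢d) ⟨ trans ⟩ indicator-true t) off-t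
    where
    off-t : ∀ k → k ≢ t → indicator t (identify c d k) ≡ false
    off-t k k≢t with k ≟ d
    ... | yes refl = indicator-false t c (≢-sym t≢c)
    ... | no _ = indicator-false t k k≢t

  module _ (a : Fin n → Bool) (z : Bool) where

    ≔∘identify-source : ((a [ c ≔ z ]) ∘ identify c d) c ≡ z
    ≔∘identify-source = cong (a [ c ≔ z ]) (identify-other c c≢d) ⟨ trans ⟩ ≔-updates a c z

    ≔∘identify-target : ((a [ c ≔ z ]) ∘ identify c d) d ≡ z
    ≔∘identify-target = cong (a [ c ≔ z ]) (identify-target c d) ⟨ trans ⟩ ≔-updates a c z

    ≔∘identify-other : ∀ k → k ≢ c → k ≢ d → ((a [ c ≔ z ]) ∘ identify c d) k ≡ a k
    ≔∘identify-other k k≢c k≢d = cong (a [ c ≔ z ]) (identify-other c k≢d) ⟨ trans ⟩ ≔-minimal a z k≢c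

  -- Switching on c switches on the path c, l together with the vertex d, which has no neighbour in it.
  essential-source : ∀ {l} → adj G c l ≡ true → Essential (fIdentify G c d) c
  essential-source {l} c~l = indicator l , λ eq → false≢true (sym off ⟨ trans ⟩ eq ⟨ trans ⟩ on)
    where
    l≢c : l ≢ c
    l≢c = ≢-sym (loopless⇒≢ G loopless c~l)
    l≢d : l ≢ d
    l≢d refl with () ← sym c≁d ⟨ trans ⟩ c~l
    y₀ y₁ : Fin n → Bool
    y₀ = (indicator l [ c ≔ false ]) ∘ identify c d
    y₁ = (indicator l [ c ≔ true ]) ∘ identify c d
    y-other : ∀ z k → k ≢ c → k ≢ d → k ≢ l → ((indicator l [ c ≔ z ]) ∘ identify c d) k ≡ false
    y-other z k k≢c k≢d k≢l = ≔∘identify-other (indicator l) z k k≢c k≢d ⟨ trans ⟩ indicator-false l k k≢l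
    y-l : ∀ z → ((indicator l [ c ≔ z ]) ∘ identify c d) l ≡ true
    y-l z = ≔∘identify-other (indicator l) z l l≢c l≢d ⟨ trans ⟩ indicator-true l
    off : fIdentify G c d (indicator l [ c ≔ false ]) ≡ false
    off = fG-singleton G loopless l (y-l false) off-l
      where
      off-l : ∀ k → k ≢ l → y₀ k ≡ false
      off-l k k≢l with toSum (k ≟ c) | toSum (k ≟ d)
      ... | inj₁ refl | _ = ≔∘identify-source (indicator l) false
      ... | inj₂ _ | inj₁ refl = ≔∘identify-target (indicator l) false
      ... | inj₂ k≢c | inj₂ k≢d = y-other false k k≢c k≢d k≢l
    on : fIdentify G c d (indicator l [ c ≔ true ]) ≡ true
    on = fG-lonely G loopless y₁ d lonely
      ⟨ trans ⟩ fG-pair G loopless c l (≢-sym l≢c) (≔-minimal y₁ false c≢d ⟨ trans ⟩ ≔∘identify-source (indicator l) true)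
                                 (≔-minimal y₁ false l≢d ⟨ trans ⟩ y-l true) off-cl
      ⟨ trans ⟩ c~l
      where
      lonely : ∀ w → adj G d w ≡ true → y₁ w ≡ false
      lonely w d~w = y-other true w (λ { refl → false≢true (sym c≁d ⟨ trans ⟩ adj-sym G w d ⟨ trans ⟩ d~w) })
                                    (λ { refl → false≢true (sym (loopless w) ⟨ trans ⟩ d~w) })
                                    (λ { refl → false≢true (sym (c~l⇒l≁d c~l) ⟨ trans ⟩ adj-sym G w d ⟨ trans ⟩ d~w) })
      off-cl : ∀ k → k ≢ c → k ≢ l → (y₁ [ d ≔ false ]) k ≡ false
      off-cl k k≢c k≢l with toSum (k ≟ d)
      ... | inj₁ refl = ≔-updates y₁ k false
      ... | inj₂ k≢d = ≔-minimal y₁ false k≢d ⟨ trans ⟩ y-other true k k≢c k≢d k≢l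

  essential : NoIsolated G → ∀ t → t ≢ d → Essential (fIdentify G c d) t
  essential no-isolated t t≢d with t ≟ c | has-neighbour G no-isolated t
  ... | yes refl | l , t~l = essential-source t~l
  ... | no t≢c | l , t~l with l ≟ c | l ≟ d
  ...   | yes refl | _ = essential-identify-inner G loopless t≢c t≢d c≢d
          (cong₂ _xor_ t~l (c~l⇒l≁d (adj-sym G l t ⟨ trans ⟩ t~l)))
  ...   | no _ | yes refl = essential-identify-inner G loopless t≢c t≢d c≢d
          (cong₂ _xor_ (adj-sym G t c ⟨ trans ⟩ t~d⇒c≁t t~l) t~l)
  ...   | no l≢c | no l≢d = essential-identify-outer G loopless t≢c t≢d t~l l≢c l≢d

-- Join-irreducible graphs are made of triangles

TriangleComponents : ∀ {n} → Graph n → Set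
TriangleComponents {n} G = ∀ v → Σ (Fin n) λ a → Σ (Fin n) λ b → IsolatedTriangle G v a b

-- For a neighbour u of v, the special vertex k of uv is the third vertex: the special vertices of vk and of uk
-- must be u and v, so the neighbourhoods of u and v are {v, k} and {u, k}.
specials⇒triangleComponents : ∀ {n} (G : Graph n) → Loopless G → NoIsolated G →
  (∀ i j → adj G i j ≡ true → ∃[ k ] Special G i j k) → TriangleComponents G
specials⇒triangleComponents G loopless no-isolated special v with has-neighbour G no-isolated v
... | u , v~u with special v u v~u
...   | k , k~v , k~u , N-k with special v k (adj-sym G v k ⟨ trans ⟩ k~v) | special u k (adj-sym G u k ⟨ trans ⟩ k~u)
...     | s , s~v , s~k , N-s | s′ , s′~u , s′~k , N-s′ = u , k , record
  { u≢a = loopless⇒≢ G loopless v~u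
  ; u≢b = ≢-sym (loopless⇒≢ G loopless k~v)
  ; a≢b = ≢-sym (loopless⇒≢ G loopless k~u)
  ; u~a = v~u
  ; u~b = adj-sym G v k ⟨ trans ⟩ k~v
  ; a~b = adj-sym G u k ⟨ trans ⟩ k~u
  ; N-u = λ w v~w → N-s′ w (cong (λ x → adj G x w) s′≡v ⟨ trans ⟩ v~w)
  ; N-a = λ w u~w → N-s w (cong (λ x → adj G x w) s≡u ⟨ trans ⟩ u~w)
  ; N-b = N-k }
  where
  s≡u : s ≡ u
  s≡u with N-k s (adj-sym G k s ⟨ trans ⟩ s~k)
  ... | inj₁ refl = ⊥-elim (loopless⇒≢ G loopless s~v refl)
  ... | inj₂ s≡u = s≡u
  s′≡v : s′ ≡ v
  s′≡v with N-k s′ (adj-sym G k s′ ⟨ trans ⟩ s′~k)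
  ... | inj₁ s′≡v = s′≡v
  ... | inj₂ refl = ⊥-elim (loopless⇒≢ G loopless s′~u refl)

-- By hypothesis every identification minor lies below the one identifying p and q.  Composing its minor map with
-- identify p q gives a map ρ that merges only p and q (Collapse), which pins down f_G on indicators pulled back along ρ.
module JoinIrreducible⇒Specials {m} (G : Graph (suc m)) (loopless : Loopless G) (no-isolated : NoIsolated G)
  {c d} (c↛d : ¬ Reachable G c d) {p q} (p≢q : p ≢ q)
  (below : ∀ i j → i ≢ j → Identification G i j ≤ₘ Identification G p q) where

  open Separated G loopless c↛d using (c≢d; fIdentify-indicator; essential)

  module Via {i j} (i≢j : i ≢ j) (essential-ij : ∀ t → t ≢ j → Essential (fIdentify G i j) t) where
    σ : Fin (suc m) → Fin (suc m)
    σ = proj₁ (below i j i≢j)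
    ρ : Fin (suc m) → Fin (suc m)
    ρ = σ ∘ identify p q
    F≡ : ∀ b → fIdentify G i j b ≡ fG G (b ∘ ρ)
    F≡ = proj₂ (below i j i≢j)
    open Collapse G ρ F≡ p≢q (cong σ (identify-other p p≢q ⟨ trans ⟩ sym (identify-target p q))) essential-ij public

  p≁q : adj G p q ≡ false
  p≁q = sym (fG-indicator-ρp loopless) ⟨ trans ⟩ sym (F≡ (indicator (ρ p))) ⟨ trans ⟩ fIdentify-indicator (ρ p)
    where open Via c≢d (essential no-isolated)

  every-edge-special : ∀ i j → adj G i j ≡ true → ∃[ k ] Special G i j k
  every-edge-special i j i~j with any? (special? G i j)
  ... | yes special = special
  ... | no no-special = ⊥-elim (false≢true (sym vanishes ⟨ trans ⟩ sym (F≡ (indicator i))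
    ⟨ trans ⟩ fIdentify-pair G loopless i≢j (indicator-true i) (indicator-false i) ⟨ trans ⟩ i~j))
    where
    i≢j = loopless⇒≢ G loopless i~j
    open Via i≢j (essential-identify-edge G loopless no-isolated i~j (λ k s → no-special (k , s)))
    vanishes : fG G (indicator i ∘ ρ) ≡ false
    vanishes with toSum (i ≟ ρ p)
    ... | inj₁ i≡ρp = cong (λ r → fG G (indicator r ∘ ρ)) i≡ρp ⟨ trans ⟩ fG-indicator-ρp loopless ⟨ trans ⟩ p≁q
    ... | inj₂ i≢ρp = fG-indicator-other loopless i i≢ρp

joinIrreducible⇒triangleComponents : ∀ {n} (G : Graph n) → Loopless G → NoIsolated G → Disconnected G →
  GraphJoinIrreducible G → TriangleComponents G
joinIrreducible⇒triangleComponents {suc m} G loopless no-isolated (c , d , c↛d) (f′ , f′<f , below-f′)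
  with <ₘgraph⇒≤ₘIdentification G c f′ f′<f
... | p , q , p≢q , f′≤pq = specials⇒triangleComponents G loopless no-isolated
  (JoinIrreducible⇒Specials.every-edge-special G loopless no-isolated c↛d p≢q below)
  where
  below : ∀ i j → i ≢ j → Identification G i j ≤ₘ Identification G p q
  below i j i≢j = ≤ₘ-trans {Identification G i j} {f′} {Identification G p q}
    (below-f′ _ (Identification≤ₘgraph G i j , graph≰ₘIdentification G (all-essential G loopless no-isolated) i j i≢j))
    f′≤pq

-- Triangles are interchangeable in the graph polynomial

Near : ∀ {n} → Graph n → Fin n → Fin n → Set
Near G x y = x ≡ y ⊎ adj G x y ≡ true

clearNbhd-outside : ∀ {n} (G : Graph n) u (y : Fin n → Bool) r → ¬ Near G u r → clearNbhd G u y r ≡ y r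
clearNbhd-outside G u y r far with r ≟ u
... | yes r≡u = ⊥-elim (far (inj₁ (sym r≡u)))
... | no _ with adj G u r
...   | true = ⊥-elim (far (inj₂ refl))
...   | false = refl

clearNbhd-far : ∀ {n} (G : Graph n) u (y y′ : Fin n → Bool) r → (¬ Near G u r → y r ≡ y′ r) →
  clearNbhd G u y r ≡ clearNbhd G u y′ r
clearNbhd-far G u y y′ r agree with r ≟ u
... | yes _ = refl
... | no r≢u with adj G u r
...   | true = refl
...   | false = agree λ { (inj₁ u≡r) → r≢u (sym u≡r) ; (inj₂ ()) }

fG-triangle-invariant : ∀ {n} (G : Graph n) → Loopless G → ∀ {u a b} → IsolatedTriangle G u a b → ∀ {y y′} →
  majority (y u) (y a) (y b) ≡ majority (y′ u) (y′ a) (y′ b) → (∀ r → ¬ Near G u r → y r ≡ y′ r) → fG G y ≡ fG G y′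
fG-triangle-invariant G loopless {u} T {y} {y′} same-majority agree =
  fG-triangle G loopless T y
  ⟨ trans ⟩ cong₂ _xor_ same-majority (fG-cong G (λ r → clearNbhd-far G u y y′ r (agree r)))
  ⟨ trans ⟩ sym (fG-triangle G loopless T y′)

fG-two-triangles-invariant : ∀ {n} (G : Graph n) → Loopless G → ∀ {u a b v c e} →
  IsolatedTriangle G u a b → IsolatedTriangle G v c e → (∀ r → Near G v r → ¬ Near G u r) → ∀ {y y′} →
  majority (y u) (y a) (y b) xor majority (y v) (y c) (y e) ≡ majority (y′ u) (y′ a) (y′ b) xor majority (y′ v) (y′ c) (y′ e) →
  (∀ r → ¬ Near G u r → ¬ Near G v r → y r ≡ y′ r) → fG G y ≡ fG G y′
fG-two-triangles-invariant G loopless {u} {a} {b} {v} {c} {e} Tu Tv separated {y} {y′} same-majorities agree =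
  expand y ⟨ trans ⟩ cong₂ _xor_ same-majorities (fG-cong G cleared-agree) ⟨ trans ⟩ sym (expand y′)
  where
  open IsolatedTriangle Tv
  cleared-agree : ∀ r → clearNbhd G v (clearNbhd G u y) r ≡ clearNbhd G v (clearNbhd G u y′) r
  cleared-agree r = clearNbhd-far G v (clearNbhd G u y) (clearNbhd G u y′) r
    (λ far-v → clearNbhd-far G u y y′ r (λ far-u → agree r far-u far-v))
  kept : ∀ z r → Near G v r → clearNbhd G u z r ≡ z r
  kept z r near = clearNbhd-outside G u z r (separated r near)
  expand : ∀ z → fG G z ≡ (majority (z u) (z a) (z b) xor majority (z v) (z c) (z e)) xor fG G (clearNbhd G v (clearNbhd G u z))
  expand z = fG-triangle G loopless Tu z
    ⟨ trans ⟩ cong (majority (z u) (z a) (z b) xor_) (fG-triangle G loopless Tv (clearNbhd G u z))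
    ⟨ trans ⟩ cong (λ m → majority (z u) (z a) (z b) xor (m xor fG G (clearNbhd G v (clearNbhd G u z))))
                   (cong₂ (λ p q → majority p q _) (kept z v (inj₁ refl)) (kept z c (inj₂ u~a))
                    ⟨ trans ⟩ cong (majority (z v) (z c)) (kept z e (inj₂ u~b)))
    ⟨ trans ⟩ sym (xor-assoc (majority (z u) (z a) (z b)) (majority (z v) (z c) (z e)) (fG G (clearNbhd G v (clearNbhd G u z))))

majority-cong : ∀ {x x′ y y′ z z′} → x ≡ x′ → y ≡ y′ → z ≡ z′ → majority x y z ≡ majority x′ y′ z′
majority-cong refl refl refl = refl

majority-swap₁₂ : ∀ x y z → majority x y z ≡ majority y x z
majority-swap₁₂ = solve 3 (λ x y z → (x :* y) :+ ((x :* z) :+ (y :* z)) := (y :* x) :+ ((y :* z) :+ (x :* z))) refl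

majority-twice₁₂ : ∀ x z → majority x x z ≡ x
majority-twice₁₂ true true = refl
majority-twice₁₂ true false = refl
majority-twice₁₂ false true = refl
majority-twice₁₂ false false = refl

majority-twice₂₃ : ∀ x z → majority z x x ≡ x
majority-twice₂₃ true true = refl
majority-twice₂₃ true false = refl
majority-twice₂₃ false true = refl
majority-twice₂₃ false false = refl

transpose-matchˡ : ∀ {n} (i j : Fin n) → transpose i j i ≡ j
transpose-matchˡ i j rewrite ==-refl i = refl

transpose-matchʳ : ∀ {n} {i j : Fin n} → i ≢ j → transpose i j j ≡ i
transpose-matchʳ {i = i} {j} i≢j rewrite ≢⇒==-false (≢-sym i≢j) | ==-refl j = refl

transpose-other : ∀ {n} {i j k : Fin n} → k ≢ i → k ≢ j → transpose i j k ≡ k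
transpose-other k≢i k≢j rewrite ≢⇒==-false k≢i | ≢⇒==-false k≢j = refl

Identification-comm : ∀ {n} (G : Graph n) i j → Identification G i j ≤ₘ Identification G j i
Identification-comm G i j with i ≟ j
... | yes refl = ≤ₘ-refl (Identification G i i)
... | no i≢j = transpose i j , λ a → fG-cong G (λ k → cong a (same k))
  where
  same : ∀ k → identify i j k ≡ transpose i j (identify j i k)
  same k with toSum (k ≟ j) | toSum (k ≟ i)
  ... | inj₁ refl | _ = identify-target i k
    ⟨ trans ⟩ sym (cong (transpose i k) (identify-other k (≢-sym i≢j)) ⟨ trans ⟩ transpose-matchʳ i≢j)
  ... | inj₂ k≢j | inj₁ refl = identify-other k k≢j
    ⟨ trans ⟩ sym (cong (transpose k j) (identify-target j k) ⟨ trans ⟩ transpose-matchʳ i≢j)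
  ... | inj₂ k≢j | inj₂ k≢i = identify-other i k≢j
    ⟨ trans ⟩ sym (cong (transpose i j) (identify-other j k≢i) ⟨ trans ⟩ transpose-other k≢i k≢j)

module TriangleGraph {n} (G : Graph n) (triangles : TriangleComponents G) where

  loopless : Loopless G
  loopless v = ¬-not (λ v~v → no-loop (triangles v) v~v)
    where
    no-loop : (Σ _ λ a → Σ _ λ b → IsolatedTriangle G v a b) → adj G v v ≢ true
    no-loop (a , b , T) v~v = [ u≢a , u≢b ]′ (N-u v v~v)
      where open IsolatedTriangle T

  no-isolated : NoIsolated G
  no-isolated v isolated with triangles v
  ... | a , b , T with () ← sym (isolated a) ⟨ trans ⟩ IsolatedTriangle.u~a T

  near? : ∀ x y → Dec (Near G x y)
  near? x y = (x ≟ y) ⊎-dec (adj G x y Bool.≟ true)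

  near-sym : ∀ {x y} → Near G x y → Near G y x
  near-sym (inj₁ x≡y) = inj₁ (sym x≡y)
  near-sym {x} {y} (inj₂ x~y) = inj₂ (adj-sym G y x ⟨ trans ⟩ x~y)

  near-trans : ∀ {x r y} → Near G x r → Near G r y → Near G x y
  near-trans (inj₁ refl) r≈y = r≈y
  near-trans x≈r (inj₁ refl) = x≈r
  near-trans {x} {r} {y} (inj₂ x~r) (inj₂ r~y) with x ≟ y | triangles r
  ... | yes x≡y | _ = inj₁ x≡y
  ... | no _ | a , b , T = within (N-u x (adj-sym G r x ⟨ trans ⟩ x~r)) (N-u y r~y)
    where
    open IsolatedTriangle T
    within : x ≡ a ⊎ x ≡ b → y ≡ a ⊎ y ≡ b → Near G x y
    within (inj₁ refl) (inj₁ refl) = inj₁ refl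
    within (inj₁ refl) (inj₂ refl) = inj₂ a~b
    within (inj₂ refl) (inj₁ refl) = inj₂ (adj-sym G x y ⟨ trans ⟩ a~b)
    within (inj₂ refl) (inj₂ refl) = inj₁ refl

  far-respects : ∀ {u v x y} → ¬ Near G u v → Near G u x → Near G v y → ¬ Near G x y
  far-respects far u≈x v≈y x≈y = far (near-trans u≈x (near-trans x≈y (near-sym v≈y)))

  far⇒≢ : ∀ {x y} → ¬ Near G x y → x ≢ y
  far⇒≢ far x≡y = far (inj₁ x≡y)

  apart : ∀ {u v p q} → ¬ Near G u v → Near G u p → Near G v q → p ≢ q
  apart u≉v u≈p v≈q = far⇒≢ (far-respects u≉v u≈p v≈q)

  far⇒≢-near : ∀ {u r p} → ¬ Near G u r → Near G u p → r ≢ p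
  far⇒≢-near u≉r u≈p refl = u≉r u≈p

  triangle-through : ∀ {i i′} → adj G i i′ ≡ true → ∃[ k ] IsolatedTriangle G i i′ k
  triangle-through {i} {i′} i~i′ with triangles i
  ... | a , b , T with IsolatedTriangle.N-u T i′ i~i′
  ...   | inj₁ refl = b , T
  ...   | inj₂ refl = a , record
    { u≢a = u≢b ; u≢b = u≢a ; a≢b = ≢-sym a≢b ; u~a = u~b ; u~b = u~a ; a~b = adj-sym G _ _ ⟨ trans ⟩ a~b
    ; N-u = λ w u~w → Sum.swap (N-u w u~w) ; N-a = N-b ; N-b = N-a }
    where open IsolatedTriangle T

  near-a : ∀ {u a b} → IsolatedTriangle G u a b → Near G u a
  near-a T = inj₂ (IsolatedTriangle.u~a T)

  near-b : ∀ {u a b} → IsolatedTriangle G u a b → Near G u b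
  near-b T = inj₂ (IsolatedTriangle.u~b T)

  -- Swapping x with its triangle neighbour x′ is an automorphism of G, and it carries the identification of
  -- x and y to that of x′ and y.
  slide : ∀ {x x′ y} → Near G x x′ → ¬ Near G x y → Identification G x y ≤ₘ Identification G x′ y
  slide {x} {y = y} (inj₁ refl) _ = ≤ₘ-refl (Identification G x y)
  slide {x} {x′} {y} (inj₂ x~x′) far with triangle-through x~x′
  ... | k , T = transpose x x′ , λ a →
    fG-triangle-invariant G loopless T (same-majority a) (λ r far-r → cong a (same-outside r far-r))
    where
    open IsolatedTriangle T
    x≢y = far⇒≢ far
    x′≢y = apart far (inj₂ x~x′) (inj₁ refl)
    k≢y = apart far (near-b T) (inj₁ refl)
    same-majority : (a : Fin n → Bool) →
      majority (a (identify x y x)) (a (identify x y x′)) (a (identify x y k))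
      ≡ majority (a (transpose x x′ (identify x′ y x))) (a (transpose x x′ (identify x′ y x′)))
                 (a (transpose x x′ (identify x′ y k)))
    same-majority a =
      majority-cong (cong a (identify-other x x≢y)) (cong a (identify-other x x′≢y)) (cong a (identify-other x k≢y))
      ⟨ trans ⟩ majority-swap₁₂ (a x) (a x′) (a k)
      ⟨ trans ⟩ sym (majority-cong
        (cong a (cong (transpose x x′) (identify-other x′ x≢y) ⟨ trans ⟩ transpose-matchˡ x x′))
        (cong a (cong (transpose x x′) (identify-other x′ x′≢y) ⟨ trans ⟩ transpose-matchʳ u≢a))
        (cong a (cong (transpose x x′) (identify-other x′ k≢y) ⟨ trans ⟩ transpose-other (≢-sym u≢b) (≢-sym a≢b))))
    same-outside : ∀ r → ¬ Near G x r → identify x y r ≡ transpose x x′ (identify x′ y r)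
    same-outside r far-r with toSum (r ≟ y)
    ... | inj₁ refl = identify-target x r
      ⟨ trans ⟩ sym (cong (transpose x x′) (identify-target x′ r) ⟨ trans ⟩ transpose-matchʳ u≢a)
    ... | inj₂ r≢y = identify-other x r≢y
      ⟨ trans ⟩ sym (cong (transpose x x′) (identify-other x′ r≢y)
                     ⟨ trans ⟩ transpose-other (far⇒≢-near far-r (inj₁ refl)) (far⇒≢-near far-r (inj₂ x~x′)))

  infixr 4 _⨾_
  _⨾_ : ∀ {i j k l i′ j′} → Identification G i j ≤ₘ Identification G k l → Identification G k l ≤ₘ Identification G i′ j′ →
    Identification G i j ≤ₘ Identification G i′ j′
  _⨾_ {i} {j} {k} {l} {i′} {j′} = ≤ₘ-trans {Identification G i j} {Identification G k l} {Identification G i′ j′}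

  slide₂ : ∀ {x y y′} → Near G y y′ → ¬ Near G x y → Identification G x y ≤ₘ Identification G x y′
  slide₂ {x} {y} {y′} y≈y′ far = Identification-comm G x y ⨾ slide y≈y′ (far ∘ near-sym) ⨾ Identification-comm G y′ x

  module TriangleSwap {y y₁ y₂ e e₁ e₂} (Ty : IsolatedTriangle G y y₁ y₂) (Te : IsolatedTriangle G e e₁ e₂)
    (y≉e : ¬ Near G y e) where

    private
      module Y = IsolatedTriangle Ty
      module E = IsolatedTriangle Te

    σ : Fin n → Fin n
    σ = transpose y e ∘ transpose y₁ e₁ ∘ transpose y₂ e₂

    σ-y : σ y ≡ e
    σ-y = cong (transpose y e ∘ transpose y₁ e₁) (transpose-other Y.u≢b (apart y≉e (inj₁ refl) (near-b Te)))
      ⟨ trans ⟩ cong (transpose y e) (transpose-other Y.u≢a (apart y≉e (inj₁ refl) (near-a Te)))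
      ⟨ trans ⟩ transpose-matchˡ y e

    σ-y₁ : σ y₁ ≡ e₁
    σ-y₁ = cong (transpose y e ∘ transpose y₁ e₁) (transpose-other Y.a≢b (apart y≉e (near-a Ty) (near-b Te)))
      ⟨ trans ⟩ cong (transpose y e) (transpose-matchˡ y₁ e₁)
      ⟨ trans ⟩ transpose-other (≢-sym (apart y≉e (inj₁ refl) (near-a Te))) (≢-sym E.u≢a)

    σ-y₂ : σ y₂ ≡ e₂
    σ-y₂ = cong (transpose y e ∘ transpose y₁ e₁) (transpose-matchˡ y₂ e₂)
      ⟨ trans ⟩ cong (transpose y e) (transpose-other (≢-sym (apart y≉e (near-a Ty) (near-b Te))) (≢-sym E.a≢b))
      ⟨ trans ⟩ transpose-other (≢-sym (apart y≉e (inj₁ refl) (near-b Te))) (≢-sym E.u≢b)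

    σ-e₁ : σ e₁ ≡ y₁
    σ-e₁ = cong (transpose y e ∘ transpose y₁ e₁) (transpose-other (≢-sym (apart y≉e (near-b Ty) (near-a Te))) E.a≢b)
      ⟨ trans ⟩ cong (transpose y e) (transpose-matchʳ (apart y≉e (near-a Ty) (near-a Te)))
      ⟨ trans ⟩ transpose-other (≢-sym Y.u≢a) (apart y≉e (near-a Ty) (inj₁ refl))

    σ-e₂ : σ e₂ ≡ y₂
    σ-e₂ = cong (transpose y e ∘ transpose y₁ e₁) (transpose-matchʳ (apart y≉e (near-b Ty) (near-b Te)))
      ⟨ trans ⟩ cong (transpose y e) (transpose-other (≢-sym Y.a≢b) (apart y≉e (near-b Ty) (near-a Te)))
      ⟨ trans ⟩ transpose-other (≢-sym Y.u≢b) (apart y≉e (near-b Ty) (inj₁ refl))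

    σ-fixes : ∀ r → ¬ Near G y r → ¬ Near G e r → σ r ≡ r
    σ-fixes r y≉r e≉r =
      cong (transpose y e ∘ transpose y₁ e₁) (transpose-other (far⇒≢-near y≉r (near-b Ty)) (far⇒≢-near e≉r (near-b Te)))
      ⟨ trans ⟩ cong (transpose y e) (transpose-other (far⇒≢-near y≉r (near-a Ty)) (far⇒≢-near e≉r (near-a Te)))
      ⟨ trans ⟩ transpose-other (far⇒≢-near y≉r (inj₁ refl)) (far⇒≢-near e≉r (inj₁ refl))

  -- Exchanging the triangles of y and e is an automorphism of G carrying the identification of x, y to that of x, e.
  reroute : ∀ {x y e} → ¬ Near G x y → ¬ Near G x e → ¬ Near G y e → Identification G x y ≤ₘ Identification G x e
  reroute {x} {y} {e} x≉y x≉e y≉e with triangles y | triangles e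
  ... | y₁ , y₂ , Ty | e₁ , e₂ , Te =
    σ , λ a → fG-two-triangles-invariant G loopless Ty Te (λ r e≈r → far-respects y≉e (inj₁ refl) e≈r)
                (majorities a) (λ r y≉r e≉r → cong a (outside r y≉r e≉r))
    where
    open TriangleSwap Ty Te y≉e
    open IsolatedTriangle
    y≢e = far⇒≢ y≉e
    majorities : (a : Fin n → Bool) →
      majority (a (identify x y y)) (a (identify x y y₁)) (a (identify x y y₂))
        xor majority (a (identify x y e)) (a (identify x y e₁)) (a (identify x y e₂))
      ≡ majority (a (σ (identify x e y))) (a (σ (identify x e y₁))) (a (σ (identify x e y₂)))
        xor majority (a (σ (identify x e e))) (a (σ (identify x e e₁))) (a (σ (identify x e e₂)))
    majorities a =
      cong₂ _xor_ (majority-cong (cong a (identify-target x y)) (cong a (identify-other x (≢-sym (u≢a Ty))))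
                                 (cong a (identify-other x (≢-sym (u≢b Ty)))))
                  (majority-cong (cong a (identify-other x (≢-sym y≢e)))
                                 (cong a (identify-other x (≢-sym (apart y≉e (inj₁ refl) (near-a Te)))))
                                 (cong a (identify-other x (≢-sym (apart y≉e (inj₁ refl) (near-b Te))))))
      ⟨ trans ⟩ xor-comm (majority (a x) (a y₁) (a y₂)) (majority (a e) (a e₁) (a e₂))
      ⟨ trans ⟩ sym (cong₂ _xor_
        (majority-cong (cong a (cong σ (identify-other x y≢e) ⟨ trans ⟩ σ-y))
                       (cong a (cong σ (identify-other x (apart y≉e (near-a Ty) (inj₁ refl))) ⟨ trans ⟩ σ-y₁))
                       (cong a (cong σ (identify-other x (apart y≉e (near-b Ty) (inj₁ refl))) ⟨ trans ⟩ σ-y₂)))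
        (majority-cong (cong a (cong σ (identify-target x e) ⟨ trans ⟩ σ-fixes x (x≉y ∘ near-sym) (x≉e ∘ near-sym)))
                       (cong a (cong σ (identify-other x (≢-sym (u≢a Te))) ⟨ trans ⟩ σ-e₁))
                       (cong a (cong σ (identify-other x (≢-sym (u≢b Te))) ⟨ trans ⟩ σ-e₂))))
    outside : ∀ r → ¬ Near G y r → ¬ Near G e r → identify x y r ≡ σ (identify x e r)
    outside r y≉r e≉r = identify-other x (far⇒≢-near y≉r (inj₁ refl))
      ⟨ trans ⟩ sym (cong σ (identify-other x (far⇒≢-near e≉r (inj₁ refl))) ⟨ trans ⟩ σ-fixes r y≉r e≉r)

  -- On the triangle x, x′, k the identification of x and x′ only sees majority (a x) (a x) (a k) = a x, which
  -- the map k, x′ ↦ x, x ↦ e reproduces as majority (a e) (a x) (a x).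
  unfold-edge : ∀ {x x′ e} → adj G x x′ ≡ true → ¬ Near G x e → Identification G x x′ ≤ₘ Identification G x e
  unfold-edge {x} {x′} {e} x~x′ x≉e with triangle-through x~x′
  ... | k , T = σ , λ a → fG-triangle-invariant G loopless T (same-majority a) (λ r x≉r → cong a (outside r x≉r))
    where
    open IsolatedTriangle T
    σ : Fin n → Fin n
    σ = (identify x k ∘ identify x x′) [ x ≔ e ]
    x≢e = far⇒≢ x≉e
    x′≢e = apart x≉e (near-a T) (inj₁ refl)
    k≢e = apart x≉e (near-b T) (inj₁ refl)
    same-majority : (a : Fin n → Bool) →
      majority (a (identify x x′ x)) (a (identify x x′ x′)) (a (identify x x′ k))
      ≡ majority (a (σ (identify x e x))) (a (σ (identify x e x′))) (a (σ (identify x e k)))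
    same-majority a =
      majority-cong (cong a (identify-other x u≢a)) (cong a (identify-target x x′)) (cong a (identify-other x (≢-sym a≢b)))
      ⟨ trans ⟩ majority-twice₁₂ (a x) (a k)
      ⟨ trans ⟩ sym (majority-twice₂₃ (a x) (a e))
      ⟨ trans ⟩ sym (majority-cong
        (cong a (cong σ (identify-other x x≢e) ⟨ trans ⟩ ≔-updates (identify x k ∘ identify x x′) x e))
        (cong a (cong σ (identify-other x x′≢e) ⟨ trans ⟩ ≔-minimal (identify x k ∘ identify x x′) e (≢-sym u≢a)
                 ⟨ trans ⟩ cong (identify x k) (identify-target x x′) ⟨ trans ⟩ identify-other x u≢b))
        (cong a (cong σ (identify-other x k≢e) ⟨ trans ⟩ ≔-minimal (identify x k ∘ identify x x′) e (≢-sym u≢b)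
                 ⟨ trans ⟩ cong (identify x k) (identify-other x (≢-sym a≢b)) ⟨ trans ⟩ identify-target x k)))
    outside : ∀ r → ¬ Near G x r → identify x x′ r ≡ σ (identify x e r)
    outside r x≉r with toSum (r ≟ e)
    ... | inj₁ refl = identify-other x (far⇒≢-near x≉r (near-a T))
      ⟨ trans ⟩ sym (cong σ (identify-target x r) ⟨ trans ⟩ ≔-updates (identify x k ∘ identify x x′) x r)
    ... | inj₂ r≢e = identify-other x r≢x′
      ⟨ trans ⟩ sym (cong σ (identify-other x r≢e) ⟨ trans ⟩ ≔-minimal (identify x k ∘ identify x x′) e r≢x
                      ⟨ trans ⟩ cong (identify x k) (identify-other x r≢x′) ⟨ trans ⟩ identify-other x (far⇒≢-near x≉r (near-b T)))
      where
      r≢x = far⇒≢-near x≉r (inj₁ refl)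
      r≢x′ = far⇒≢-near x≉r (near-a T)

  module _ {c d} (c≉d : ¬ Near G c d) where

    from-c≤ : ∀ {y} → ¬ Near G c y → Identification G c y ≤ₘ Identification G c d
    from-c≤ {y} c≉y with near? y d
    ... | yes y≈d = slide₂ y≈d c≉y
    ... | no y≉d = reroute c≉y c≉d y≉d

    far-pair≤ : ∀ {x y} → ¬ Near G x y → Identification G x y ≤ₘ Identification G c d
    far-pair≤ {x} {y} x≉y with near? x c | near? y c
    ... | yes x≈c | _ = slide x≈c x≉y ⨾ from-c≤ (far-respects x≉y x≈c (inj₁ refl))
    ... | no _ | yes y≈c =
      Identification-comm G x y ⨾ slide y≈c (x≉y ∘ near-sym) ⨾ from-c≤ (far-respects (x≉y ∘ near-sym) y≈c (inj₁ refl))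
    ... | no x≉c | no y≉c = reroute x≉y x≉c y≉c ⨾ Identification-comm G x c ⨾ from-c≤ (x≉c ∘ near-sym)

    Identification≤ : ∀ i j → i ≢ j → Identification G i j ≤ₘ Identification G c d
    Identification≤ i j i≢j with near? i j
    ... | no i≉j = far-pair≤ i≉j
    ... | yes (inj₁ i≡j) = ⊥-elim (i≢j i≡j)
    ... | yes (inj₂ i~j) with near? i c
    ...   | no i≉c = unfold-edge i~j i≉c ⨾ far-pair≤ i≉c
    ...   | yes i≈c = unfold-edge i~j i≉d ⨾ far-pair≤ i≉d
      where
      i≉d = far-respects c≉d (near-sym i≈c) (inj₁ refl)

triangleComponents⇒joinIrreducible : ∀ {n} (G : Graph n) → TriangleComponents G → Disconnected G → GraphJoinIrreducible G
triangleComponents⇒joinIrreducible G triangles (c , d , c↛d) =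
  Identification G c d , (Identification≤ₘgraph G c d , graph≰ₘIdentification G essential c d c≢d) , below
  where
  open TriangleGraph G triangles
  open Separated G loopless c↛d using (c≢d; c≁d)
  c≉d : ¬ Near G c d
  c≉d (inj₁ c≡d) = c≢d c≡d
  c≉d (inj₂ c~d) with () ← sym c≁d ⟨ trans ⟩ c~d
  essential = all-essential G loopless no-isolated
  below : ∀ g → g <ₘ graphFun G → g ≤ₘ Identification G c d
  below g g<f with <ₘgraph⇒≤ₘIdentification G c g g<f
  ... | i , j , i≢j , g≤ij = ≤ₘ-trans {g} {Identification G i j} {Identification G c d} g≤ij (Identification≤ c≉d i j i≢j)

record Embedding {m N} (S : Graph m) (B : Graph N) : Set where
  field
    embed : Fin m → Fin N
    injective : ∀ x y → embed x ≡ embed y → x ≡ y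
    adj-embed : ∀ i j → adj S i j ≡ adj B (embed i) (embed j)

  -- the image is a union of connected components of B
  Closed : Set
  Closed = ∀ u w → adj B (embed u) w ≡ true → ∃[ w′ ] embed w′ ≡ w

module _ {m N} {S : Graph m} {B : Graph N} (ι : Embedding S B) where
  open Embedding ι

  IsolatedTriangle-pullback : ∀ {u a b} → IsolatedTriangle B (embed u) (embed a) (embed b) → IsolatedTriangle S u a b
  IsolatedTriangle-pullback {u} {a} {b} T = record
    { u≢a = u≢a ∘ cong embed ; u≢b = u≢b ∘ cong embed ; a≢b = a≢b ∘ cong embed
    ; u~a = adj-embed u a ⟨ trans ⟩ u~a ; u~b = adj-embed u b ⟨ trans ⟩ u~b ; a~b = adj-embed a b ⟨ trans ⟩ a~b
    ; N-u = λ w u~w → Sum.map (injective w a) (injective w b) (N-u (embed w) (sym (adj-embed u w) ⟨ trans ⟩ u~w))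
    ; N-a = λ w a~w → Sum.map (injective w u) (injective w b) (N-a (embed w) (sym (adj-embed a w) ⟨ trans ⟩ a~w))
    ; N-b = λ w b~w → Sum.map (injective w u) (injective w a) (N-b (embed w) (sym (adj-embed b w) ⟨ trans ⟩ b~w)) }
    where open IsolatedTriangle T

  IsolatedTriangle-pushforward : Closed → ∀ {u a b} → IsolatedTriangle S u a b →
    IsolatedTriangle B (embed u) (embed a) (embed b)
  IsolatedTriangle-pushforward closed {u} {a} {b} T = record
    { u≢a = u≢a ∘ injective u a ; u≢b = u≢b ∘ injective u b ; a≢b = a≢b ∘ injective a b
    ; u~a = sym (adj-embed u a) ⟨ trans ⟩ u~a ; u~b = sym (adj-embed u b) ⟨ trans ⟩ u~b ; a~b = sym (adj-embed a b) ⟨ trans ⟩ a~b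
    ; N-u = neighbours u N-u ; N-a = neighbours a N-a ; N-b = neighbours b N-b }
    where
    open IsolatedTriangle T
    neighbours : ∀ v {p q} → (∀ w → adj S v w ≡ true → w ≡ p ⊎ w ≡ q) →
      ∀ w → adj B (embed v) w ≡ true → w ≡ embed p ⊎ w ≡ embed q
    neighbours v N-v w v~w with closed v w v~w
    ... | w′ , refl = Sum.map (cong embed) (cong embed) (N-v w′ (adj-embed v w′ ⟨ trans ⟩ v~w))

  TriangleComponents-pullback : Closed → TriangleComponents B → TriangleComponents S
  TriangleComponents-pullback closed triangles v with triangles (embed v)
  ... | A , B′ , T with closed v A (IsolatedTriangle.u~a T) | closed v B′ (IsolatedTriangle.u~b T)
  ...   | a , refl | b , refl = a , b , IsolatedTriangle-pullback T

≅⇒Embedding : ∀ {n m} {G : Graph n} {H : Graph m} → G ≅ H → Embedding G H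
≅⇒Embedding (π , adj-π) = record
  { embed = to ; injective = λ x y eq → sym (strictlyInverseʳ x) ⟨ trans ⟩ cong from eq ⟨ trans ⟩ strictlyInverseʳ y
  ; adj-embed = adj-π }
  where open Inverse π

TriangleComponents-≅ : ∀ {n m} {G : Graph n} {H : Graph m} → G ≅ H → TriangleComponents H → TriangleComponents G
TriangleComponents-≅ G≅H@(π , _) = TriangleComponents-pullback (≅⇒Embedding G≅H)
  (λ u w _ → Inverse.from π w , Inverse.strictlyInverseˡ π w)

≅-trans : ∀ {n m p} {G : Graph n} {H : Graph m} {K : Graph p} → G ≅ H → H ≅ K → G ≅ K
≅-trans (π , adj-π) (ρ , adj-ρ) = π ∘ₚ ρ , λ i j → adj-π i j ⟨ trans ⟩ adj-ρ (π ⟨$⟩ʳ i) (π ⟨$⟩ʳ j)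

↑-view : ∀ n {m} (w : Fin (n + m)) → (∃[ w′ ] w′ ↑ˡ m ≡ w) ⊎ (∃[ w′ ] n ↑ʳ w′ ≡ w)
↑-view n w with splitAt n w in eq
... | inj₁ w′ = inj₁ (w′ , splitAt⁻¹-↑ˡ eq)
... | inj₂ w′ = inj₂ (w′ , splitAt⁻¹-↑ʳ eq)

module _ {n m} (G : Graph n) (H : Graph m) where

  ⊕-adjˡˡ : ∀ i j → adj (G ⊕ H) (i ↑ˡ m) (j ↑ˡ m) ≡ adj G i j
  ⊕-adjˡˡ i j rewrite splitAt-↑ˡ n i m | splitAt-↑ˡ n j m = refl

  ⊕-adjʳʳ : ∀ i j → adj (G ⊕ H) (n ↑ʳ i) (n ↑ʳ j) ≡ adj H i j
  ⊕-adjʳʳ i j rewrite splitAt-↑ʳ n m i | splitAt-↑ʳ n m j = refl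

  ⊕-adjˡʳ : ∀ i j → adj (G ⊕ H) (i ↑ˡ m) (n ↑ʳ j) ≡ false
  ⊕-adjˡʳ i j rewrite splitAt-↑ˡ n i m | splitAt-↑ʳ n m j = refl

  ⊕-adjʳˡ : ∀ i j → adj (G ⊕ H) (n ↑ʳ i) (j ↑ˡ m) ≡ false
  ⊕-adjʳˡ i j rewrite splitAt-↑ʳ n m i | splitAt-↑ˡ n j m = refl

  ⊕-embedˡ : Embedding G (G ⊕ H)
  ⊕-embedˡ = record { embed = _↑ˡ m ; injective = ↑ˡ-injective m ; adj-embed = λ i j → sym (⊕-adjˡˡ i j) }

  ⊕-embedʳ : Embedding H (G ⊕ H)
  ⊕-embedʳ = record { embed = n ↑ʳ_ ; injective = ↑ʳ-injective n ; adj-embed = λ i j → sym (⊕-adjʳʳ i j) }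

  ⊕-embedˡ-closed : Embedding.Closed ⊕-embedˡ
  ⊕-embedˡ-closed u w u~w with ↑-view n w
  ... | inj₁ image = image
  ... | inj₂ (w′ , refl) with () ← sym (⊕-adjˡʳ u w′) ⟨ trans ⟩ u~w

  ⊕-embedʳ-closed : Embedding.Closed ⊕-embedʳ
  ⊕-embedʳ-closed u w u~w with ↑-view n w
  ... | inj₂ image = image
  ... | inj₁ (w′ , refl) with () ← sym (⊕-adjʳˡ u w′) ⟨ trans ⟩ u~w

  TriangleComponents-⊕ : TriangleComponents G → TriangleComponents H → TriangleComponents (G ⊕ H)
  TriangleComponents-⊕ triangles-G triangles-H w with ↑-view n w
  ... | inj₁ (v , refl) with triangles-G v
  ...   | a , b , T = a ↑ˡ m , b ↑ˡ m , IsolatedTriangle-pushforward ⊕-embedˡ ⊕-embedˡ-closed T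
  TriangleComponents-⊕ triangles-G triangles-H w | inj₂ (v , refl) with triangles-H v
  ...   | a , b , T = n ↑ʳ a , n ↑ʳ b , IsolatedTriangle-pushforward ⊕-embedʳ ⊕-embedʳ-closed T

⊕-congʳ : ∀ {n m m′} (G : Graph n) {H : Graph m} {H′ : Graph m′} → H ≅ H′ → (G ⊕ H) ≅ (G ⊕ H′)
⊕-congʳ {n} {m} {m′} G {H} {H′} (π , adj-π) =
  mk↔ₛ′ (lift to) (lift from) (lift-inverse strictlyInverseˡ) (lift-inverse strictlyInverseʳ) , adj-lift
  where
  open Inverse π
  lift : ∀ {k l} → (Fin k → Fin l) → Fin (n + k) → Fin (n + l)
  lift h i = join n _ (Sum.map₂ h (splitAt n i))
  lift-↑ˡ : ∀ {k l} (h : Fin k → Fin l) v → lift h (v ↑ˡ k) ≡ v ↑ˡ l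
  lift-↑ˡ {k} h v = cong (join n _ ∘ Sum.map₂ h) (splitAt-↑ˡ n v k)
  lift-↑ʳ : ∀ {k l} (h : Fin k → Fin l) v → lift h (n ↑ʳ v) ≡ n ↑ʳ h v
  lift-↑ʳ {k} h v = cong (join n _ ∘ Sum.map₂ h) (splitAt-↑ʳ n k v)
  lift-inverse : ∀ {k l} {f : Fin k → Fin l} {g : Fin l → Fin k} → (∀ x → f (g x) ≡ x) → ∀ i → lift f (lift g i) ≡ i
  lift-inverse {f = f} {g} fg i with ↑-view n i
  ... | inj₁ (v , refl) = cong (lift f) (lift-↑ˡ g v) ⟨ trans ⟩ lift-↑ˡ f v
  ... | inj₂ (v , refl) = cong (lift f) (lift-↑ʳ g v) ⟨ trans ⟩ lift-↑ʳ f (g v) ⟨ trans ⟩ cong (n ↑ʳ_) (fg v)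
  adj-lift : ∀ i j → adj (G ⊕ H) i j ≡ adj (G ⊕ H′) (lift to i) (lift to j)
  adj-lift i j with ↑-view n i | ↑-view n j
  ... | inj₁ (v , refl) | inj₁ (w , refl) =
    ⊕-adjˡˡ G H v w ⟨ trans ⟩ sym (cong₂ (adj (G ⊕ H′)) (lift-↑ˡ to v) (lift-↑ˡ to w) ⟨ trans ⟩ ⊕-adjˡˡ G H′ v w)
  ... | inj₁ (v , refl) | inj₂ (w , refl) =
    ⊕-adjˡʳ G H v w ⟨ trans ⟩ sym (cong₂ (adj (G ⊕ H′)) (lift-↑ˡ to v) (lift-↑ʳ to w) ⟨ trans ⟩ ⊕-adjˡʳ G H′ v (to w))
  ... | inj₂ (v , refl) | inj₁ (w , refl) =
    ⊕-adjʳˡ G H v w ⟨ trans ⟩ sym (cong₂ (adj (G ⊕ H′)) (lift-↑ʳ to v) (lift-↑ˡ to w) ⟨ trans ⟩ ⊕-adjʳˡ G H′ (to v) w)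
  ... | inj₂ (v , refl) | inj₂ (w , refl) =
    ⊕-adjʳʳ G H v w ⟨ trans ⟩ adj-π v w
    ⟨ trans ⟩ sym (cong₂ (adj (G ⊕ H′)) (lift-↑ʳ to v) (lift-↑ʳ to w) ⟨ trans ⟩ ⊕-adjʳʳ G H′ (to v) (to w))

≅-sym : ∀ {n m} {G : Graph n} {H : Graph m} → G ≅ H → H ≅ G
≅-sym {H = H} (π , adj-π) = Perm.flip π , λ i j →
  cong₂ (adj H) (sym (inverseʳ π)) (sym (inverseʳ π)) ⟨ trans ⟩ sym (adj-π (π ⟨$⟩ˡ i) (π ⟨$⟩ˡ j))

-- Graphs made of triangles are disjoint unions of triangles

TriangleComponents-K₃ : TriangleComponents K₃
TriangleComponents-K₃ zero = suc zero , suc (suc zero) , record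
  { u≢a = λ () ; u≢b = λ () ; a≢b = λ () ; u~a = refl ; u~b = refl ; a~b = refl
  ; N-u = λ { zero () ; (suc zero) _ → inj₁ refl ; (suc (suc zero)) _ → inj₂ refl }
  ; N-a = λ { zero _ → inj₁ refl ; (suc zero) () ; (suc (suc zero)) _ → inj₂ refl }
  ; N-b = λ { zero _ → inj₁ refl ; (suc zero) _ → inj₂ refl ; (suc (suc zero)) () } }
TriangleComponents-K₃ (suc zero) = zero , suc (suc zero) , record
  { u≢a = λ () ; u≢b = λ () ; a≢b = λ () ; u~a = refl ; u~b = refl ; a~b = refl
  ; N-u = λ { zero _ → inj₁ refl ; (suc zero) () ; (suc (suc zero)) _ → inj₂ refl }
  ; N-a = λ { zero () ; (suc zero) _ → inj₁ refl ; (suc (suc zero)) _ → inj₂ refl }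
  ; N-b = λ { zero _ → inj₂ refl ; (suc zero) _ → inj₁ refl ; (suc (suc zero)) () } }
TriangleComponents-K₃ (suc (suc zero)) = zero , suc zero , record
  { u≢a = λ () ; u≢b = λ () ; a≢b = λ () ; u~a = refl ; u~b = refl ; a~b = refl
  ; N-u = λ { zero _ → inj₁ refl ; (suc zero) _ → inj₂ refl ; (suc (suc zero)) () }
  ; N-a = λ { zero () ; (suc zero) _ → inj₂ refl ; (suc (suc zero)) _ → inj₁ refl }
  ; N-b = λ { zero _ → inj₂ refl ; (suc zero) () ; (suc (suc zero)) _ → inj₁ refl } }

TriangleComponents-copies : ∀ k → TriangleComponents (copies k K₃)
TriangleComponents-copies zero = λ ()
TriangleComponents-copies (suc k) = TriangleComponents-⊕ K₃ (copies k K₃) TriangleComponents-K₃ (TriangleComponents-copies k)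

relabel : ∀ {n} → Graph n → Permutation′ n → Graph n
relabel G ρ = record { adj = λ x y → adj G (ρ ⟨$⟩ʳ x) (ρ ⟨$⟩ʳ y) ; adj-sym = λ x y → adj-sym G (ρ ⟨$⟩ʳ x) (ρ ⟨$⟩ʳ y) }

relabel-≅ : ∀ {n} (G : Graph n) ρ → relabel G ρ ≅ G
relabel-≅ G ρ = ρ , λ i j → refl

IsolatedTriangle-cong : ∀ {n} {G : Graph n} {u a b u′ a′ b′} → u ≡ u′ → a ≡ a′ → b ≡ b′ →
  IsolatedTriangle G u a b → IsolatedTriangle G u′ a′ b′
IsolatedTriangle-cong refl refl refl T = T

-- the triangle of 0 is moved to the front by transposing 1 with a and then 2 with (the new position of) b
to-front : ∀ {m} {a b : Fin (3 + m)} → a ≢ zero → b ≢ zero → a ≢ b →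
  Σ (Permutation′ (3 + m)) λ ρ → ρ ⟨$⟩ʳ zero ≡ zero × ρ ⟨$⟩ʳ suc zero ≡ a × ρ ⟨$⟩ʳ suc (suc zero) ≡ b
to-front {a = a} {b} a≢0 b≢0 a≢b = ρ , ρ0 , ρ1 , ρ2
  where
  b′ = transpose a (suc zero) b
  ρ = Perm.transpose (suc (suc zero)) b′ ∘ₚ Perm.transpose (suc zero) a
  fixes-0 : ∀ {x} → x ≢ zero → transpose (suc zero) x zero ≡ zero
  fixes-0 x≢0 = transpose-other {i = suc zero} {k = zero} (λ ()) (≢-sym x≢0)
  back : transpose (suc zero) a b′ ≡ b
  back = transpose-inverse (suc zero) a
  b′≢0 : b′ ≢ zero
  b′≢0 b′≡0 = b≢0 (sym back ⟨ trans ⟩ cong (transpose (suc zero) a) b′≡0 ⟨ trans ⟩ fixes-0 a≢0)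
  b′≢1 : b′ ≢ suc zero
  b′≢1 b′≡1 = a≢b (sym (transpose-matchˡ (suc zero) a) ⟨ trans ⟩ sym (cong (transpose (suc zero) a) b′≡1) ⟨ trans ⟩ back)
  ρ0 : ρ ⟨$⟩ʳ zero ≡ zero
  ρ0 = cong (transpose (suc zero) a) (transpose-other {i = suc (suc zero)} {k = zero} (λ ()) (≢-sym b′≢0)) ⟨ trans ⟩ fixes-0 a≢0
  ρ1 : ρ ⟨$⟩ʳ suc zero ≡ a
  ρ1 = cong (transpose (suc zero) a) (transpose-other {i = suc (suc zero)} {k = suc zero} (λ ()) (≢-sym b′≢1))
    ⟨ trans ⟩ transpose-matchˡ (suc zero) a
  ρ2 : ρ ⟨$⟩ʳ suc (suc zero) ≡ b
  ρ2 = cong (transpose (suc zero) a) (transpose-matchˡ (suc (suc zero)) b′) ⟨ trans ⟩ back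

drop-K₃ : ∀ {m} → Graph (3 + m) → Graph m
drop-K₃ H = record { adj = λ x y → adj H (3 ↑ʳ x) (3 ↑ʳ y) ; adj-sym = λ x y → adj-sym H (3 ↑ʳ x) (3 ↑ʳ y) }

module FrontTriangle {m} (H : Graph (3 + m)) (loopless : Loopless H)
  (T : IsolatedTriangle H zero (suc zero) (suc (suc zero))) where
  open IsolatedTriangle T

  ≅K₃⊕drop : H ≅ (K₃ ⊕ drop-K₃ H)
  ≅K₃⊕drop = Perm.id , same
    where
    off₀ : ∀ y → adj H zero (3 ↑ʳ y) ≡ false
    off₀ y = non-neighbour H N-u (3 ↑ʳ y) (λ ()) (λ ())
    off₁ : ∀ y → adj H (suc zero) (3 ↑ʳ y) ≡ false
    off₁ y = non-neighbour H N-a (3 ↑ʳ y) (λ ()) (λ ())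
    off₂ : ∀ y → adj H (suc (suc zero)) (3 ↑ʳ y) ≡ false
    off₂ y = non-neighbour H N-b (3 ↑ʳ y) (λ ()) (λ ())
    same : ∀ i j → adj H i j ≡ adj (K₃ ⊕ drop-K₃ H) i j
    same zero zero = loopless zero
    same zero (suc zero) = u~a
    same zero (suc (suc zero)) = u~b
    same (suc zero) zero = adj-sym H _ _ ⟨ trans ⟩ u~a
    same (suc zero) (suc zero) = loopless (suc zero)
    same (suc zero) (suc (suc zero)) = a~b
    same (suc (suc zero)) zero = adj-sym H _ _ ⟨ trans ⟩ u~b
    same (suc (suc zero)) (suc zero) = adj-sym H _ _ ⟨ trans ⟩ a~b
    same (suc (suc zero)) (suc (suc zero)) = loopless (suc (suc zero))
    same zero (suc (suc (suc y))) = off₀ y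
    same (suc zero) (suc (suc (suc y))) = off₁ y
    same (suc (suc zero)) (suc (suc (suc y))) = off₂ y
    same (suc (suc (suc x))) zero = adj-sym H _ _ ⟨ trans ⟩ off₀ x
    same (suc (suc (suc x))) (suc zero) = adj-sym H _ _ ⟨ trans ⟩ off₁ x
    same (suc (suc (suc x))) (suc (suc zero)) = adj-sym H _ _ ⟨ trans ⟩ off₂ x
    same (suc (suc (suc x))) (suc (suc (suc y))) = refl

  drop-embedding : Embedding (drop-K₃ H) H
  drop-embedding = record { embed = 3 ↑ʳ_ ; injective = ↑ʳ-injective 3 ; adj-embed = λ i j → refl }

  drop-closed : Embedding.Closed drop-embedding
  drop-closed u (suc (suc (suc w))) _ = w , refl
  drop-closed u zero u~w with N-u (3 ↑ʳ u) (adj-sym H _ _ ⟨ trans ⟩ u~w)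
  ... | inj₁ ()
  ... | inj₂ ()
  drop-closed u (suc zero) u~w with N-a (3 ↑ʳ u) (adj-sym H _ _ ⟨ trans ⟩ u~w)
  ... | inj₁ ()
  ... | inj₂ ()
  drop-closed u (suc (suc zero)) u~w with N-b (3 ↑ʳ u) (adj-sym H _ _ ⟨ trans ⟩ u~w)
  ... | inj₁ ()
  ... | inj₂ ()

triangleComponents⇒copies : ∀ n (G : Graph n) → TriangleComponents G → ∃[ k ] G ≅ copies k K₃
triangleComponents⇒copies zero G _ = 0 , Perm.id , λ ()
triangleComponents⇒copies (suc zero) G triangles with triangles zero
... | zero , _ , T = ⊥-elim (IsolatedTriangle.u≢a T refl)
triangleComponents⇒copies (suc (suc zero)) G triangles with triangles zero
... | zero , _ , T = ⊥-elim (IsolatedTriangle.u≢a T refl)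
... | suc zero , zero , T = ⊥-elim (IsolatedTriangle.u≢b T refl)
... | suc zero , suc zero , T = ⊥-elim (IsolatedTriangle.a≢b T refl)
triangleComponents⇒copies (suc (suc (suc m))) G triangles with triangles zero
... | a , b , T with to-front (≢-sym (IsolatedTriangle.u≢a T)) (≢-sym (IsolatedTriangle.u≢b T)) (IsolatedTriangle.a≢b T)
...   | ρ , ρ0 , ρ1 , ρ2 =
  prepend-K₃ (triangleComponents⇒copies m (drop-K₃ H) (TriangleComponents-pullback drop-embedding drop-closed triangles-H))
  where
  H = relabel G ρ
  triangles-H = TriangleComponents-≅ (relabel-≅ G ρ) triangles
  T-H : IsolatedTriangle H zero (suc zero) (suc (suc zero))
  T-H = IsolatedTriangle-pullback (≅⇒Embedding (relabel-≅ G ρ)) (IsolatedTriangle-cong (sym ρ0) (sym ρ1) (sym ρ2) T)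
  open FrontTriangle H (TriangleGraph.loopless H triangles-H) T-H
  prepend-K₃ : ∃[ k ] drop-K₃ H ≅ copies k K₃ → ∃[ k ] G ≅ copies k K₃
  prepend-K₃ (k , drop≅) = suc k , ≅-trans {G = G} {H = H} {K = copies (suc k) K₃} (≅-sym {G = H} {H = G} (relabel-≅ G ρ))
    (≅-trans {G = H} {H = K₃ ⊕ drop-K₃ H} {K = K₃ ⊕ copies k K₃} ≅K₃⊕drop (⊕-congʳ K₃ {H′ = copies k K₃} drop≅))

K₃-near : ∀ x y → Near (copies 1 K₃) x y
K₃-near zero zero = inj₁ refl
K₃-near zero (suc zero) = inj₂ refl
K₃-near zero (suc (suc zero)) = inj₂ refl
K₃-near (suc zero) zero = inj₂ refl
K₃-near (suc zero) (suc zero) = inj₁ refl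
K₃-near (suc zero) (suc (suc zero)) = inj₂ refl
K₃-near (suc (suc zero)) zero = inj₂ refl
K₃-near (suc (suc zero)) (suc zero) = inj₂ refl
K₃-near (suc (suc zero)) (suc (suc zero)) = inj₁ refl

disconnected⇒two-triangles : ∀ {n} {G : Graph n} {k} → Disconnected G → G ≅ copies k K₃ → 2 ≤ k
disconnected⇒two-triangles {k = zero} (c , _) (π , _) with Inverse.to π c
... | ()
disconnected⇒two-triangles {G = G} {k = suc zero} (c , d , c↛d) (π , adj-π) = ⊥-elim (c↛d (reach (K₃-near (to c) (to d))))
  where
  open Inverse π
  reach : Near (copies 1 K₃) (to c) (to d) → Reachable G c d
  reach (inj₁ same) = subst (Reachable G c) (sym (strictlyInverseʳ c) ⟨ trans ⟩ cong from same ⟨ trans ⟩ strictlyInverseʳ d) ε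
  reach (inj₂ c~d) = (adj-π c d ⟨ trans ⟩ c~d) ◅ ε
disconnected⇒two-triangles {k = suc (suc k)} _ _ = s≤s (s≤s z≤n)

proposition4p1 : ∀ {n} (G : Graph n) → Loopless G → NoIsolated G → Disconnected G →
    (GraphJoinIrreducible G ⇔ (∃[ k ] (2 ≤ k × G ≅ copies k K₃)))
proposition4p1 {n} G loopless no-isolated disconnected = mk⇔ ⇒ ⇐
  where
  ⇒ : GraphJoinIrreducible G → ∃[ k ] (2 ≤ k × G ≅ copies k K₃)
  ⇒ join-irreducible with triangleComponents⇒copies n G
    (joinIrreducible⇒triangleComponents G loopless no-isolated disconnected join-irreducible)
  ... | k , G≅ = k , disconnected⇒two-triangles {G = G} disconnected G≅ , G≅
  ⇐ : ∃[ k ] (2 ≤ k × G ≅ copies k K₃) → GraphJoinIrreducible G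
  ⇐ (k , _ , G≅) = triangleComponents⇒joinIrreducible G (TriangleComponents-≅ {G = G} G≅ (TriangleComponents-copies k)) disconnected
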